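{- Let $\mathcal{L}$ be a many-sorted signature and let $\mathcal{L}^+$ be obtained from $\mathcal{L}$ by making all relation symbols liberal (i.e. setting $\mathrm{rank}^+(R)=\mathrm{Sort}^n$ for every $n$-ary relation symbol $R$, everything else unchanged). Then for every set $\Gamma\cup\{\varphi\}$ of well-sorted $\mathcal{L}^\approx$-formulas, $$\Gamma\vdash^{\mathcal{L}}_{\mathrm{MSL}^\approx}\varphi\quad\text{if and only if}\quad\Gamma\vdash^{\mathcal{L}^+}_{\mathrm{MSL}^\approx}\varphi.$$
   Context: A many-sorted signature $\mathcal{L}$ consists of countable sets of relation and function symbols with arities (0-ary function symbols are constants); a nonempty countable set $\mathrm{Sort}$; pairwise disjoint countably infinite sets $\mathrm{Var}_i$ of variables of sort $i$, written $x^i$; and $\mathrm{rank}$ assigning to each $n$-ary relation symbol $R$ a nonempty $\mathrm{rank}(R)\subseteq\mathrm{Sort}^n$ and to each $n$-ary function symbol $f$ a nonempty partial function $\mathrm{rank}(f)\subseteq\mathrm{Sort}^n\times\mathrm{Sort}$. Well-sorted terms: variables of $\mathrm{Var}_i$ have sort $i$; $f(t_1,\dots,t_n)$ has sort $i$ if the $t_k$ have sorts $i_k$ and $(i_1,\dots,i_n,i)\in\mathrm{rank}(f)$. Well-sorted formulas: $\bot$; $t_1=t_2$ for terms of the same sort; $R(t_1,\dots,t_n)$ when the tuple of sorts lies in $\mathrm{rank}(R)$; closure under $\land,\lor,\to,\exists x^i,\forall x^i$. $\Gamma\vdash^{\mathcal{L}}_{\mathrm{MSL}}\varphi$: derivability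 in classical natural deduction with sorted quantifier rules ($\forall E$, $\exists I$ instantiate a variable of sort $i$ only by well-sorted terms of sort $i$; usual eigenvariable conditions), all formulas well-sorted for $\mathcal{L}$, plus universal closures of the sorted equality axioms ($x^i=x^i$, symmetry and transitivity at each sort, congruence for $R$ at each tuple in $\mathrm{rank}(R)$ and for $f$ at each tuple in the domain of $\mathrm{rank}(f)$). $\mathcal{L}^\approx$ extends $\mathcal{L}$ by a binary relation symbol $\approx$ with $\mathrm{rank}(\approx)=\mathrm{Sort}\times\mathrm{Sort}$. $\mathrm{Eq}^\approx_{\mathcal{L}}$ is the set of universal closures of: $x^i\approx x^i$; $x^i\approx y^j\to y^j\approx x^i$; $x^i\approx y^j\land y^j\approx z^k\to x^i\approx z^k$; $\bigwedge_k x_k^{i_k}\approx y_k^{j_k}\to(R(x_1^{i_1},\dots,x_n^{i_n})\to R(y_1^{j_1},\dots,y_n^{j_n}))$ whenever both $R$-atoms are well sorted; $\bigwedge_k x_k^{i_k}\approx y_k^{j_k}\to f(x_1^{i_1},\dots,x_n^{i_n})\approx f(y_1^{j_1},\dots,y_n^{j_n})$ whenever both $f$-terms are well sorted; $x^i=y^i\to x^i\approx y^i$; $x^i\approx y^i\to x^i=y^i$. $\Gamma\vdash^{\mathcal{L}}_{\mathrm{MSL}^\approx}\varphi$ means $\Gamma,\mathrm{Eq}^\approx_{\mathcal{L}}\vdash^{\mathcal{L}^\approx}_{\mathrm{MSL}}\varphi$ (analogously for $\mathcal{L}^+$, using $\mathrm{Eq}^\approx_{\mathcal{L}^+}$). 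-}

module Defs where

open import Data.Nat using (ℕ; zero; suc; pred; _+_; _<_; _≤?_)
open import Data.Nat.Properties using (<-cmp; suc-injective)
import Data.Nat.Properties as ℕP
open import Data.Fin using (Fin; toℕ)
open import Data.Maybe using (Maybe; just; nothing)
open import Data.Vec using (Vec; []; _∷_; lookup; tabulate; zipWith; replicate)
open import Data.List using (List; []; _∷_)
open import Data.Product using (Σ; ∃; ∃₂; _×_; _,_)
open import Data.Sum using (_⊎_)
open import Data.Unit using (⊤; tt)
open import Function using (Injective)
open import Relation.Binary using (Tri; tri<; tri≈; tri>; DecidableEquality)
open import Relation.Binary.PropositionalEquality using (_≡_; refl; cong)
open import Relation.Nullary using (yes; no; map′)

Countable : Set → Set
Countable A = Σ (A → ℕ) (λ c → Injective _≡_ _≡_ c)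

record Symbols : Set₁ where
  field
    Sort      : Set
    Rel       : Set
    Fun       : Set
    rarity    : Rel → ℕ
    farity    : Fun → ℕ
    sortCount : Countable Sort
    someSort  : Sort
    relCount  : Countable Rel
    funCount  : Countable Fun

  _≟ₛ_ : DecidableEquality Sort
  s ≟ₛ s' with sortCount
  ... | c , inj = map′ inj (cong c) (c s ℕP.≟ c s')

open Symbols public

record Signature (S : Symbols) : Set₁ where
  field
    relRank          : (R : Rel S) → Vec (Sort S) (rarity S R) → Set
    relRank-nonempty : ∀ R → ∃ (relRank R)
    funRank          : (f : Fun S) → Vec (Sort S) (farity S f) → Sort S → Set
    funRank-partial  : ∀ f ss i j → funRank f ss i → funRank f ss j → i ≡ j
    funRank-nonempty : ∀ f → ∃₂ (funRank f)

open Signature public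

-- Variables of sort i are  var i n  (n : ℕ); we use
-- per-sort de Bruijn indices: a quantifier ∀x^i / ∃x^i binds index 0
-- of sort i and only shifts the indices of variables of sort i.

module _ (S : Symbols) where
  data Term : Set where
    var : Sort S → ℕ → Term
    app : (f : Fun S) → Vec Term (farity S f) → Term

  infixr 6 _∧'_
  infixr 5 _∨'_
  infixr 4 _⇒_
  infix 7 _≐_
  data Formula : Set where
    ⊥'   : Formula
    _≐_  : Term → Term → Formula
    rel  : (R : Rel S) → Vec Term (rarity S R) → Formula
    _∧'_ : Formula → Formula → Formula
    _∨'_ : Formula → Formula → Formula
    _⇒_  : Formula → Formula → Formula
    all  : Sort S → Formula → Formula
    ex   : Sort S → Formula → Formula

module Syntax {S : Symbols} where
  private
    _≟_ = _≟ₛ_ S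

  -- cutoff / index adjustment when passing a binder of sort b,
  -- relative to variables of sort s
  bumpIf : Sort S → Sort S → ℕ → ℕ
  bumpIf b s c with b ≟ s
  ... | yes _ = suc c
  ... | no _  = c

  mutual
    shiftT : Sort S → ℕ → Term S → Term S
    shiftT s c (var s' n) with s' ≟ s | c ≤? n
    ... | yes _ | yes _ = var s' (suc n)
    ... | _     | _     = var s' n
    shiftT s c (app f ts) = app f (shiftTs s c ts)

    shiftTs : ∀ {m} → Sort S → ℕ → Vec (Term S) m → Vec (Term S) m
    shiftTs s c []       = []
    shiftTs s c (t ∷ ts) = shiftT s c t ∷ shiftTs s c ts

  shiftF : Sort S → ℕ → Formula S → Formula S
  shiftF s c ⊥'        = ⊥'
  shiftF s c (t ≐ u)   = shiftT s c t ≐ shiftT s c u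
  shiftF s c (rel R ts) = rel R (shiftTs s c ts)
  shiftF s c (φ ∧' ψ)  = shiftF s c φ ∧' shiftF s c ψ
  shiftF s c (φ ∨' ψ)  = shiftF s c φ ∨' shiftF s c ψ
  shiftF s c (φ ⇒ ψ)   = shiftF s c φ ⇒ shiftF s c ψ
  shiftF s c (all b φ) = all b (shiftF s (bumpIf b s c) φ)
  shiftF s c (ex b φ)  = ex b (shiftF s (bumpIf b s c) φ)

  mutual
    substT : Sort S → ℕ → Term S → Term S → Term S
    substT s k u (var s' n) with s' ≟ s
    ... | no _ = var s' n
    ... | yes _ with <-cmp n k
    ...   | tri< _ _ _ = var s' n
    ...   | tri≈ _ _ _ = u
    ...   | tri> _ _ _ = var s' (pred n)
    substT s k u (app f ts) = app f (substTs s k u ts)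

    substTs : ∀ {m} → Sort S → ℕ → Term S → Vec (Term S) m → Vec (Term S) m
    substTs s k u []       = []
    substTs s k u (t ∷ ts) = substT s k u t ∷ substTs s k u ts

  substF : Sort S → ℕ → Term S → Formula S → Formula S
  substF s k u ⊥'         = ⊥'
  substF s k u (t ≐ t')   = substT s k u t ≐ substT s k u t'
  substF s k u (rel R ts) = rel R (substTs s k u ts)
  substF s k u (φ ∧' ψ)   = substF s k u φ ∧' substF s k u ψ
  substF s k u (φ ∨' ψ)   = substF s k u φ ∨' substF s k u ψ
  substF s k u (φ ⇒ ψ)    = substF s k u φ ⇒ substF s k u ψ
  substF s k u (all b φ)  = all b (substF s (bumpIf b s k) (shiftT b 0 u) φ)
  substF s k u (ex b φ)   = ex b (substF s (bumpIf b s k) (shiftT b 0 u) φ)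

  -- φ(t/x^s) where x^s is the variable bound by the outermost quantifier
  inst : Sort S → Formula S → Term S → Formula S
  inst s φ t = substF s 0 t φ

  mutual
    BelowT : (Sort S → ℕ) → Term S → Set
    BelowT d (var s n)  = n < d s
    BelowT d (app f ts) = BelowTs d ts

    BelowTs : ∀ {m} → (Sort S → ℕ) → Vec (Term S) m → Set
    BelowTs d []       = ⊤
    BelowTs d (t ∷ ts) = BelowT d t × BelowTs d ts

  bumpD : Sort S → (Sort S → ℕ) → Sort S → ℕ
  bumpD b d s = bumpIf b s (d s)

  BelowF : (Sort S → ℕ) → Formula S → Set
  BelowF d ⊥'         = ⊤
  BelowF d (t ≐ u)    = BelowT d t × BelowT d u
  BelowF d (rel R ts) = BelowTs d ts
  BelowF d (φ ∧' ψ)   = BelowF d φ × BelowF d ψ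
  BelowF d (φ ∨' ψ)   = BelowF d φ × BelowF d ψ
  BelowF d (φ ⇒ ψ)    = BelowF d φ × BelowF d ψ
  BelowF d (all b φ)  = BelowF (bumpD b d) φ
  BelowF d (ex b φ)   = BelowF (bumpD b d) φ

  Closed : Formula S → Set
  Closed = BelowF (λ _ → 0)

  allPrefix : List (Sort S) → Formula S → Formula S
  allPrefix []       ψ = ψ
  allPrefix (s ∷ ss) ψ = all s (allPrefix ss ψ)

  UnivClosures : (Formula S → Set) → Formula S → Set
  UnivClosures A χ =
    Σ (Formula S) λ ψ → A ψ × Σ (List (Sort S)) λ ss → χ ≡ allPrefix ss ψ × Closed χ

  -- iterated conjunction (empty conjunction = ⊥ → ⊥, i.e. ⊤)
  bigAnd : ∀ {m} → Vec (Formula S) m → Formula S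
  bigAnd []           = ⊥' ⇒ ⊥'
  bigAnd (a ∷ [])     = a
  bigAnd (a ∷ b ∷ as) = a ∧' bigAnd (b ∷ as)

  -- the variable tuples x_1..x_n (indices 0..n-1) and y_1..y_n (indices n..2n-1)
  xs : ∀ {n} → Vec (Sort S) n → Vec (Term S) n
  xs ss = tabulate (λ k → var (lookup ss k) (toℕ k))

  ys : ∀ {n} → Vec (Sort S) n → Vec (Term S) n
  ys {n} ss = tabulate (λ k → var (lookup ss k) (n + toℕ k))

  _∪_ : (Formula S → Set) → (Formula S → Set) → Formula S → Set
  (A ∪ B) χ = A χ ⊎ B χ

  _,,_ : (Formula S → Set) → Formula S → Formula S → Set
  (A ,, φ) χ = χ ≡ φ ⊎ A χ

  shiftSet : Sort S → (Formula S → Set) → Formula S → Set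
  shiftSet s A χ = Σ (Formula S) λ χ' → A χ' × χ ≡ shiftF s 0 χ'

open Syntax public

module WellSorted {S : Symbols} (L : Signature S) where
  mutual
    data HasSort : Term S → Sort S → Set where
      var : ∀ i n → HasSort (var i n) i
      app : ∀ {f ts ss i} → HasSorts ts ss → funRank L f ss i → HasSort (app f ts) i

    data HasSorts : ∀ {m} → Vec (Term S) m → Vec (Sort S) m → Set where
      []  : HasSorts [] []
      _∷_ : ∀ {m t i} {ts : Vec (Term S) m} {ss} →
            HasSort t i → HasSorts ts ss → HasSorts (t ∷ ts) (i ∷ ss)

  data WF : Formula S → Set where
    ⊥'   : WF ⊥'
    eq   : ∀ {t u i} → HasSort t i → HasSort u i → WF (t ≐ u)
    rel  : ∀ {R ts ss} → HasSorts ts ss → relRank L R ss → WF (rel R ts)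
    _∧'_ : ∀ {φ ψ} → WF φ → WF ψ → WF (φ ∧' ψ)
    _∨'_ : ∀ {φ ψ} → WF φ → WF ψ → WF (φ ∨' ψ)
    _⇒_  : ∀ {φ ψ} → WF φ → WF ψ → WF (φ ⇒ ψ)
    all  : ∀ {φ} i → WF φ → WF (all i φ)
    ex   : ∀ {φ} i → WF φ → WF (ex i φ)

open WellSorted public

module _ {S : Symbols} (L : Signature S) where
  data Der (Δ : Formula S → Set) : Formula S → Set where
    hyp  : ∀ {φ} → Δ φ → WF L φ → Der Δ φ
    ⊥E   : ∀ {φ} → Der Δ ⊥' → WF L φ → Der Δ φ
    raa  : ∀ {φ} → Der (Δ ,, (φ ⇒ ⊥')) ⊥' → WF L φ → Der Δ φ
    ∧I   : ∀ {φ ψ} → Der Δ φ → Der Δ ψ → WF L (φ ∧' ψ) → Der Δ (φ ∧' ψ)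
    ∧E₁  : ∀ {φ ψ} → Der Δ (φ ∧' ψ) → WF L φ → Der Δ φ
    ∧E₂  : ∀ {φ ψ} → Der Δ (φ ∧' ψ) → WF L ψ → Der Δ ψ
    ∨I₁  : ∀ {φ ψ} → Der Δ φ → WF L (φ ∨' ψ) → Der Δ (φ ∨' ψ)
    ∨I₂  : ∀ {φ ψ} → Der Δ ψ → WF L (φ ∨' ψ) → Der Δ (φ ∨' ψ)
    ∨E   : ∀ {φ ψ χ} → Der Δ (φ ∨' ψ) → Der (Δ ,, φ) χ → Der (Δ ,, ψ) χ →
           WF L χ → Der Δ χ
    ⇒I   : ∀ {φ ψ} → Der (Δ ,, φ) ψ → WF L (φ ⇒ ψ) → Der Δ (φ ⇒ ψ)
    ⇒E   : ∀ {φ ψ} → Der Δ (φ ⇒ ψ) → Der Δ φ → WF L ψ → Der Δ ψ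
    -- eigenvariable condition: the fresh variable is index 0 of sort i,
    -- all free variables of sort i in Δ are shifted away from it
    ∀I   : ∀ {i φ} → Der (shiftSet i Δ) φ → WF L (all i φ) → Der Δ (all i φ)
    ∀E   : ∀ {i φ t} → Der Δ (all i φ) → HasSort L t i →
           WF L (inst i φ t) → Der Δ (inst i φ t)
    ∃I   : ∀ {i φ t} → Der Δ (inst i φ t) → HasSort L t i →
           WF L (ex i φ) → Der Δ (ex i φ)
    ∃E   : ∀ {i φ ψ} → Der Δ (ex i φ) → Der (shiftSet i Δ ,, φ) (shiftF i 0 ψ) →
           WF L ψ → Der Δ ψ

  -- sorted equality axioms (open versions; closed under universal closure below)
  data OpenEqAx : Formula S → Set where
    eq-refl  : ∀ i → OpenEqAx (var i 0 ≐ var i 0)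
    eq-sym   : ∀ i → OpenEqAx (var i 0 ≐ var i 1 ⇒ var i 1 ≐ var i 0)
    eq-trans : ∀ i → OpenEqAx (var i 0 ≐ var i 1 ∧' var i 1 ≐ var i 2 ⇒ var i 0 ≐ var i 2)
    eq-rel   : ∀ R ss → relRank L R ss →
               OpenEqAx (bigAnd (zipWith _≐_ (xs ss) (ys ss)) ⇒
                         (rel R (xs ss) ⇒ rel R (ys ss)))
    eq-fun   : ∀ f ss i → funRank L f ss i →
               OpenEqAx (bigAnd (zipWith _≐_ (xs ss) (ys ss)) ⇒
                         app f (xs ss) ≐ app f (ys ss))

  EqAx : Formula S → Set
  EqAx = UnivClosures OpenEqAx

  MSL⊢ : (Formula S → Set) → Formula S → Set
  MSL⊢ Γ φ = Der (Γ ∪ EqAx) φ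

-- The extension L^≈ : new binary relation symbol ≈ (encoded as nothing)

Maybe-countable : ∀ {A : Set} → Countable A → Countable (Maybe A)
Maybe-countable {A} (c , inj) = c' , inj'
  where
    c' : Maybe A → ℕ
    c' nothing  = zero
    c' (just a) = suc (c a)
    inj' : ∀ {x y} → c' x ≡ c' y → x ≡ y
    inj' {nothing} {nothing} _ = refl
    inj' {nothing} {just _} ()
    inj' {just _} {nothing} ()
    inj' {just a} {just b} e = cong just (inj (suc-injective e))

_≈Sym : Symbols → Symbols
S ≈Sym = record
  { Sort = Sort S ; Rel = Maybe (Rel S) ; Fun = Fun S
  ; rarity = ar ; farity = farity S
  ; sortCount = sortCount S ; someSort = someSort S
  ; relCount = Maybe-countable (relCount S) ; funCount = funCount S }
  where
    ar : Maybe (Rel S) → ℕ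
    ar nothing  = 2
    ar (just R) = rarity S R

_≈Sig : ∀ {S} → Signature S → Signature (S ≈Sym)
_≈Sig {S} L = record
  { relRank = rk ; relRank-nonempty = rkne
  ; funRank = funRank L ; funRank-partial = funRank-partial L
  ; funRank-nonempty = funRank-nonempty L }
  where
    rk : (R : Maybe (Rel S)) → Vec (Sort S) (rarity (S ≈Sym) R) → Set
    rk nothing  _  = ⊤
    rk (just R) ss = relRank L R ss
    rkne : ∀ R → ∃ (rk R)
    rkne nothing  = someSort S ∷ someSort S ∷ [] , tt
    rkne (just R) = relRank-nonempty L R

liberal : ∀ {S} → Signature S → Signature S
liberal {S} L = record
  { relRank = λ _ _ → ⊤ ; relRank-nonempty = λ R → replicate _ (someSort S) , tt
  ; funRank = funRank L ; funRank-partial = funRank-partial L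
  ; funRank-nonempty = funRank-nonempty L }

module _ {S : Symbols} (L : Signature S) where
  _≈'_ : Term (S ≈Sym) → Term (S ≈Sym) → Formula (S ≈Sym)
  t ≈' u = rel nothing (t ∷ u ∷ [])

  private
    xs≈ ys≈ : ∀ {n} → Vec (Sort S) n → Vec (Term (S ≈Sym)) n
    xs≈ = xs {S ≈Sym}
    ys≈ = ys {S ≈Sym}

  data OpenEq≈ : Formula (S ≈Sym) → Set where
    ap-refl  : ∀ i → OpenEq≈ (var i 0 ≈' var i 0)
    ap-sym   : ∀ i j → OpenEq≈ (var i 0 ≈' var j 1 ⇒ var j 1 ≈' var i 0)
    ap-trans : ∀ i j k →
               OpenEq≈ (var i 0 ≈' var j 1 ∧' var j 1 ≈' var k 2 ⇒ var i 0 ≈' var k 2)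
    ap-rel   : ∀ R ss ts → relRank L R ss → relRank L R ts →
               OpenEq≈ (bigAnd (zipWith _≈'_ (xs≈ ss) (ys≈ ts)) ⇒
                        (rel (just R) (xs≈ ss) ⇒ rel (just R) (ys≈ ts)))
    ap-fun   : ∀ f ss ts i j → funRank L f ss i → funRank L f ts j →
               OpenEq≈ (bigAnd (zipWith _≈'_ (xs≈ ss) (ys≈ ts)) ⇒
                        app f (xs≈ ss) ≈' app f (ys≈ ts))
    eq⇒ap    : ∀ i → OpenEq≈ (var i 0 ≐ var i 1 ⇒ var i 0 ≈' var i 1)
    ap⇒eq    : ∀ i → OpenEq≈ (var i 0 ≈' var i 1 ⇒ var i 0 ≐ var i 1)

  Eq≈ : Formula (S ≈Sym) → Set
  Eq≈ = UnivClosures OpenEq≈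

  MSL≈⊢ : (Formula (S ≈Sym) → Set) → Formula (S ≈Sym) → Set
  MSL≈⊢ Γ φ = MSL⊢ (L ≈Sig) (Γ ∪ Eq≈) φ

module Submission where

-- From L to L⁺ nothing changes: every formula, rank and axiom of L is one of L⁺.
-- Conversely, a derivation in L⁺ uses finitely many premises, so only finitely many rank entries
-- (R, s₁ … sₙ) of L occur in them and in φ.  Translate each atom R(t₁, …, tₙ) into the disjunction,
-- over these entries, of ∃y₁ … ∃yₙ (y₁ ≈ t₁ ∧ … ∧ R(y₁, …, yₙ)) with yₖ of sort sₖ.  The translation is
-- well sorted in L, commutes with substitution and maps every axiom of L⁺ to a theorem of L (the
-- liberal congruences for R reduce to transitivity of ≈), so it maps L⁺-derivations to L-derivations;
-- and with the ≈-axioms of L it is equivalent to every formula whose atoms all have listed ranks,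
-- in particular to φ and to the premises.

open import Data.Empty using (⊥-elim)
open import Data.List using (List; []; _∷_; _++_; replicate; concatMap; length)
import Data.List as List
import Data.List.Properties as ListP
open import Data.List.Membership.Propositional using (_∈_)
open import Data.List.Membership.Propositional.Properties using (∈-map⁺; ∈-map⁻)
open import Data.List.Relation.Binary.Pointwise using (Pointwise; []; _∷_)
import Data.List.Relation.Binary.Pointwise as Pointwise
open import Data.List.Relation.Unary.All using (All; []; _∷_)
import Data.List.Relation.Unary.All.Properties as All
open import Data.List.Relation.Unary.Any using (Any; here; there)
open import Data.List.Relation.Unary.Any.Properties using (++⁺ˡ; ++⁺ʳ)
import Data.Nat as ℕ
open import Data.Nat using (ℕ; zero; suc; pred; _+_; _<_; _≤_; _≤?_; z≤n; s≤s)
open import Data.Nat.Properties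
  using (<-cmp; ≤-<-connex; ≤-refl; ≤-trans; ≤-pred; n≤1+n; <-irrefl; <-≤-trans;
         +-suc; +-identityʳ; +-monoʳ-≤)
open import Data.Fin using (Fin)
import Data.Fin as Fin
open import Data.Maybe using (Maybe; just; nothing)
import Data.Maybe as Maybe
open import Data.Product using (Σ; _×_; _,_; proj₁; proj₂)
open import Data.Unit using (⊤; tt)
open import Data.Sum using (_⊎_; inj₁; inj₂)
open import Data.Vec using (Vec; []; _∷_)
import Data.Vec as Vec
import Data.Vec.Properties as VecP
open import Function using (id; _∘_; case_of_)
open import Relation.Binary using (DecidableEquality; tri<; tri≈; tri>)
open import Relation.Binary.PropositionalEquality using (_≡_; refl; sym; trans; cong; cong₂; subst; ≢-sym)
open import Relation.Nullary using (¬_; yes; no; map′)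
open import Relation.Nullary.Decidable using (toSum)
open import Relation.Unary using (_⊆′_)
open import Relation.Unary.Properties using (⊆′-trans)

open import Defs
  hiding (bumpIf; shiftT; shiftTs; shiftF; substT; substTs; substF; inst; BelowT; BelowTs; bumpD; BelowF; Closed;
          allPrefix; UnivClosures; bigAnd; xs; ys; _∪_; _,,_; shiftSet)

module SortedIndices {S : Symbols} where
  open Syntax {S}

  private
    _≟_ = _≟ₛ_ S

  -- Splitting on this rather than on a ≟ b keeps the occurrences of a ≟ b inside shiftT and substT
  -- intact, so that the rewriting lemmas below still apply.
  sort-cases : (a b : Sort S) → a ≡ b ⊎ ¬ a ≡ b
  sort-cases a b = toSum (a ≟ b)

  ≟-refl : (s : Sort S) → (s ≟ s) ≡ yes refl
  ≟-refl s with s ≟ s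
  ... | yes refl = refl
  ... | no s≢s = ⊥-elim (s≢s refl)

  ≟-≢ : {s s' : Sort S} → ¬ s ≡ s' → Σ (¬ s ≡ s') λ q → (s ≟ s') ≡ no q
  ≟-≢ {s} {s'} s≢s' with s ≟ s'
  ... | yes p = ⊥-elim (s≢s' p)
  ... | no q = q , refl

  bumpIf-same : ∀ s c → bumpIf s s c ≡ suc c
  bumpIf-same s c rewrite ≟-refl s = refl

  bumpIf-other : ∀ {b s} c → ¬ b ≡ s → bumpIf b s c ≡ c
  bumpIf-other c b≢s with ≟-≢ b≢s
  ... | _ , e rewrite e = refl

  bumpIf-mono-≤ : ∀ x s {a b} → a ≤ b → bumpIf x s a ≤ bumpIf x s b
  bumpIf-mono-≤ x s {a} {b} a≤b with sort-cases x s
  ... | inj₁ refl rewrite bumpIf-same x a | bumpIf-same x b = s≤s a≤b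
  ... | inj₂ x≢s rewrite bumpIf-other a x≢s | bumpIf-other b x≢s = a≤b

  bumpIf-suc : ∀ x s c → bumpIf x s (suc c) ≡ suc (bumpIf x s c)
  bumpIf-suc x s c with sort-cases x s
  ... | inj₁ refl rewrite bumpIf-same x c | bumpIf-same x (suc c) = refl
  ... | inj₂ x≢s rewrite bumpIf-other c x≢s | bumpIf-other (suc c) x≢s = refl

  bumpIf-≥ : ∀ x s c → c ≤ bumpIf x s c
  bumpIf-≥ x s c with sort-cases x s
  ... | inj₁ refl rewrite bumpIf-same x c = n≤1+n c
  ... | inj₂ x≢s rewrite bumpIf-other c x≢s = ≤-refl

  shiftT-var-other : ∀ {s s'} c n → ¬ s' ≡ s → shiftT s c (var s' n) ≡ var s' n
  shiftT-var-other c n s'≢s with ≟-≢ s'≢s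
  ... | _ , e rewrite e = refl

  shiftT-var-≥ : ∀ s {c n} → c ≤ n → shiftT s c (var s n) ≡ var s (suc n)
  shiftT-var-≥ s {c} {n} c≤n rewrite ≟-refl s with c ≤? n
  ... | yes _ = refl
  ... | no c≰n = ⊥-elim (c≰n c≤n)

  shiftT-var-< : ∀ s {c n} → n < c → shiftT s c (var s n) ≡ var s n
  shiftT-var-< s {c} {n} n<c rewrite ≟-refl s with c ≤? n
  ... | yes c≤n = ⊥-elim (<-irrefl refl (<-≤-trans n<c c≤n))
  ... | no _ = refl

  shiftT-var-0 : ∀ b s k → shiftT b 0 (var s k) ≡ var s (bumpIf b s k)
  shiftT-var-0 b s k with sort-cases s b
  ... | inj₁ refl rewrite shiftT-var-≥ s {0} {k} z≤n | bumpIf-same s k = refl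
  ... | inj₂ s≢b rewrite shiftT-var-other 0 k s≢b | bumpIf-other k (≢-sym s≢b) = refl

  shiftT-var : ∀ b c s n → Σ ℕ λ m → shiftT b c (var s n) ≡ var s m
  shiftT-var b c s n with s ≟ b | c ≤? n
  ... | yes _ | yes _ = suc n , refl
  ... | yes _ | no _ = n , refl
  ... | no _ | _ = n , refl

  substT-var-other : ∀ {s s'} k u n → ¬ s' ≡ s → substT s k u (var s' n) ≡ var s' n
  substT-var-other k u n s'≢s with ≟-≢ s'≢s
  ... | _ , e rewrite e = refl

  substT-var-< : ∀ s {k n} u → n < k → substT s k u (var s n) ≡ var s n
  substT-var-< s {k} {n} u n<k rewrite ≟-refl s with <-cmp n k
  ... | tri< _ _ _ = refl
  ... | tri≈ n≮k _ _ = ⊥-elim (n≮k n<k)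
  ... | tri> n≮k _ _ = ⊥-elim (n≮k n<k)

  substT-var-≡ : ∀ s k u → substT s k u (var s k) ≡ u
  substT-var-≡ s k u rewrite ≟-refl s with <-cmp k k
  ... | tri< _ k≢k _ = ⊥-elim (k≢k refl)
  ... | tri≈ _ _ _ = refl
  ... | tri> _ k≢k _ = ⊥-elim (k≢k refl)

  substT-var-> : ∀ s {k n} u → k < n → substT s k u (var s n) ≡ var s (pred n)
  substT-var-> s {k} {n} u k<n rewrite ≟-refl s with <-cmp n k
  ... | tri< _ _ n≯k = ⊥-elim (n≯k k<n)
  ... | tri≈ _ _ n≯k = ⊥-elim (n≯k k<n)
  ... | tri> _ _ _ = refl

  substT-var : ∀ s k u s' n →
               (s' ≡ s × substT s k u (var s' n) ≡ u) ⊎ Σ ℕ λ m → substT s k u (var s' n) ≡ var s' m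
  substT-var s k u s' n with s' ≟ s
  ... | no _ = inj₂ (n , refl)
  ... | yes s'≡s with <-cmp n k
  ...   | tri< _ _ _ = inj₂ (n , refl)
  ...   | tri≈ _ _ _ = inj₁ (s'≡s , refl)
  ...   | tri> _ _ _ = inj₂ (pred n , refl)

  shiftT-comm-var : ∀ s b c d s' n → (b ≡ s → d ≤ c) →
                    shiftT s (bumpIf b s c) (shiftT b d (var s' n)) ≡ shiftT b d (shiftT s c (var s' n))
  shiftT-comm-var s b c d s' n d≤c with sort-cases b s
  shiftT-comm-var s .s c d s' n d≤c | inj₁ refl rewrite bumpIf-same s c with sort-cases s' s
  ... | inj₂ s'≢s rewrite shiftT-var-other d n s'≢s | shiftT-var-other (suc c) n s'≢s
                        | shiftT-var-other c n s'≢s | shiftT-var-other d n s'≢s = refl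
  ... | inj₁ refl with ≤-<-connex d n
  ...   | inj₂ n<d rewrite shiftT-var-< s n<d | shiftT-var-< s {suc c} (≤-trans n<d (≤-trans (d≤c refl) (n≤1+n c)))
                         | shiftT-var-< s {c} (≤-trans n<d (d≤c refl)) | shiftT-var-< s n<d = refl
  ...   | inj₁ d≤n rewrite shiftT-var-≥ s d≤n with ≤-<-connex c n
  ...     | inj₁ c≤n rewrite shiftT-var-≥ s {suc c} (s≤s c≤n) | shiftT-var-≥ s c≤n
                           | shiftT-var-≥ s {d} (≤-trans d≤n (n≤1+n n)) = refl
  ...     | inj₂ n<c rewrite shiftT-var-< s {suc c} (s≤s n<c) | shiftT-var-< s n<c | shiftT-var-≥ s d≤n = refl
  shiftT-comm-var s b c d s' n d≤c | inj₂ b≢s rewrite bumpIf-other c b≢s with sort-cases s' s | sort-cases s' b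
  ... | inj₁ refl | inj₁ refl = ⊥-elim (b≢s refl)
  ... | inj₁ refl | inj₂ s≢b with ≤-<-connex c n
  ...   | inj₁ c≤n rewrite shiftT-var-other d n s≢b | shiftT-var-≥ s c≤n | shiftT-var-other d (suc n) s≢b = refl
  ...   | inj₂ n<c rewrite shiftT-var-other d n s≢b | shiftT-var-< s n<c | shiftT-var-other d n s≢b = refl
  shiftT-comm-var s b c d s' n d≤c | inj₂ b≢s | inj₂ s'≢s | inj₁ refl with ≤-<-connex d n
  ... | inj₁ d≤n rewrite shiftT-var-≥ b d≤n | shiftT-var-other c n s'≢s
                       | shiftT-var-other c (suc n) s'≢s | shiftT-var-≥ b d≤n = refl
  ... | inj₂ n<d rewrite shiftT-var-< b n<d | shiftT-var-other c n s'≢s | shiftT-var-< b n<d = refl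
  shiftT-comm-var s b c d s' n d≤c | inj₂ b≢s | inj₂ s'≢s | inj₂ s'≢b
    rewrite shiftT-var-other d n s'≢b | shiftT-var-other c n s'≢s | shiftT-var-other d n s'≢b = refl

  mutual
    shiftT-comm : ∀ s b c d t → (b ≡ s → d ≤ c) →
                  shiftT s (bumpIf b s c) (shiftT b d t) ≡ shiftT b d (shiftT s c t)
    shiftT-comm s b c d (var s' n) d≤c = shiftT-comm-var s b c d s' n d≤c
    shiftT-comm s b c d (app f ts) d≤c = cong (app f) (shiftTs-comm s b c d ts d≤c)

    shiftTs-comm : ∀ {m} s b c d (ts : Vec (Term S) m) → (b ≡ s → d ≤ c) →
                   shiftTs s (bumpIf b s c) (shiftTs b d ts) ≡ shiftTs b d (shiftTs s c ts)
    shiftTs-comm s b c d [] d≤c = refl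
    shiftTs-comm s b c d (t ∷ ts) d≤c = cong₂ _∷_ (shiftT-comm s b c d t d≤c) (shiftTs-comm s b c d ts d≤c)

  substT-shiftT-comm-var : ∀ s b k c u s' n → (b ≡ s → c ≤ k) →
                           substT s (bumpIf b s k) (shiftT b c u) (shiftT b c (var s' n))
                             ≡ shiftT b c (substT s k u (var s' n))
  substT-shiftT-comm-var s b k c u s' n c≤k with sort-cases b s
  substT-shiftT-comm-var s .s k c u s' n c≤k | inj₁ refl rewrite bumpIf-same s k with sort-cases s' s
  ... | inj₂ s'≢s rewrite shiftT-var-other c n s'≢s | substT-var-other (suc k) (shiftT s c u) n s'≢s
                        | substT-var-other k u n s'≢s | shiftT-var-other c n s'≢s = refl
  ... | inj₁ refl with ≤-<-connex c n
  ...   | inj₂ n<c rewrite shiftT-var-< s n<c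
                         | substT-var-< s (shiftT s c u) (≤-trans n<c (≤-trans (c≤k refl) (n≤1+n k)))
                         | substT-var-< s u (≤-trans n<c (c≤k refl)) | shiftT-var-< s n<c = refl
  ...   | inj₁ c≤n rewrite shiftT-var-≥ s c≤n with <-cmp n k
  ...     | tri< n<k _ _ rewrite substT-var-< s (shiftT s c u) (s≤s n<k) | substT-var-< s u n<k
                               | shiftT-var-≥ s c≤n = refl
  ...     | tri≈ _ refl _ rewrite substT-var-≡ s (suc n) (shiftT s c u) | substT-var-≡ s n u = refl
  substT-shiftT-comm-var s .s k c u s' (suc n) c≤k | inj₁ refl | inj₁ refl | inj₁ c≤n | tri> _ _ k<n
    rewrite substT-var-> s (shiftT s c u) (s≤s k<n) | substT-var-> s u k<n
          | shiftT-var-≥ s {c} {n} (≤-trans (c≤k refl) (≤-pred k<n)) = refl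
  substT-shiftT-comm-var s b k c u s' n c≤k | inj₂ b≢s rewrite bumpIf-other k b≢s with sort-cases s' s
  substT-shiftT-comm-var s b k c u s' n c≤k | inj₂ b≢s | inj₁ refl
    rewrite shiftT-var-other c n (≢-sym b≢s) with <-cmp n k
  ... | tri< n<k _ _ rewrite substT-var-< s (shiftT b c u) n<k | substT-var-< s u n<k
                           | shiftT-var-other c n (≢-sym b≢s) = refl
  ... | tri≈ _ refl _ rewrite substT-var-≡ s n (shiftT b c u) | substT-var-≡ s n u = refl
  ... | tri> _ _ k<n rewrite substT-var-> s (shiftT b c u) k<n | substT-var-> s u k<n
                           | shiftT-var-other c (pred n) (≢-sym b≢s) = refl
  substT-shiftT-comm-var s b k c u s' n c≤k | inj₂ b≢s | inj₂ s'≢s with shiftT-var b c s' n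
  ... | m , e rewrite e | substT-var-other k (shiftT b c u) m s'≢s | substT-var-other k u n s'≢s | e = refl

  mutual
    substT-shiftT-comm : ∀ s b k c u t → (b ≡ s → c ≤ k) →
                         substT s (bumpIf b s k) (shiftT b c u) (shiftT b c t) ≡ shiftT b c (substT s k u t)
    substT-shiftT-comm s b k c u (var s' n) c≤k = substT-shiftT-comm-var s b k c u s' n c≤k
    substT-shiftT-comm s b k c u (app f ts) c≤k = cong (app f) (substTs-shiftTs-comm s b k c u ts c≤k)

    substTs-shiftTs-comm : ∀ {m} s b k c u (ts : Vec (Term S) m) → (b ≡ s → c ≤ k) →
                           substTs s (bumpIf b s k) (shiftT b c u) (shiftTs b c ts) ≡ shiftTs b c (substTs s k u ts)
    substTs-shiftTs-comm s b k c u [] c≤k = refl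
    substTs-shiftTs-comm s b k c u (t ∷ ts) c≤k =
      cong₂ _∷_ (substT-shiftT-comm s b k c u t c≤k) (substTs-shiftTs-comm s b k c u ts c≤k)

  substT-shiftT-cancel-var : ∀ s k u s' n → substT s k u (shiftT s k (var s' n)) ≡ var s' n
  substT-shiftT-cancel-var s k u s' n with sort-cases s' s
  ... | inj₂ s'≢s rewrite shiftT-var-other k n s'≢s | substT-var-other k u n s'≢s = refl
  ... | inj₁ refl with ≤-<-connex k n
  ...   | inj₁ k≤n rewrite shiftT-var-≥ s k≤n | substT-var-> s u (s≤s k≤n) = refl
  ...   | inj₂ n<k rewrite shiftT-var-< s n<k | substT-var-< s u n<k = refl

  mutual
    substT-shiftT-cancel : ∀ s k u t → substT s k u (shiftT s k t) ≡ t
    substT-shiftT-cancel s k u (var s' n) = substT-shiftT-cancel-var s k u s' n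
    substT-shiftT-cancel s k u (app f ts) = cong (app f) (substTs-shiftTs-cancel s k u ts)

    substTs-shiftTs-cancel : ∀ {m} s k u (ts : Vec (Term S) m) → substTs s k u (shiftTs s k ts) ≡ ts
    substTs-shiftTs-cancel s k u [] = refl
    substTs-shiftTs-cancel s k u (t ∷ ts) = cong₂ _∷_ (substT-shiftT-cancel s k u t) (substTs-shiftTs-cancel s k u ts)

  substT-var-shiftT-var : ∀ s k s' n → substT s k (var s k) (shiftT s (suc k) (var s' n)) ≡ var s' n
  substT-var-shiftT-var s k s' n with sort-cases s' s
  ... | inj₂ s'≢s rewrite shiftT-var-other (suc k) n s'≢s | substT-var-other k (var s k) n s'≢s = refl
  ... | inj₁ refl with ≤-<-connex (suc k) n
  ...   | inj₁ k<n rewrite shiftT-var-≥ s k<n | substT-var-> s (var s k) (≤-trans k<n (n≤1+n n)) = refl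
  ...   | inj₂ n<1+k with <-cmp n k
  ...     | tri< n<k _ _ rewrite shiftT-var-< s n<1+k | substT-var-< s (var s k) n<k = refl
  ...     | tri≈ _ refl _ rewrite shiftT-var-< s n<1+k | substT-var-≡ s n (var s n) = refl
  ...     | tri> _ _ k<n = ⊥-elim (<-irrefl refl (≤-trans n<1+k k<n))

  mutual
    substT-var-shiftT : ∀ s k t → substT s k (var s k) (shiftT s (suc k) t) ≡ t
    substT-var-shiftT s k (var s' n) = substT-var-shiftT-var s k s' n
    substT-var-shiftT s k (app f ts) = cong (app f) (substTs-var-shiftTs s k ts)

    substTs-var-shiftTs : ∀ {m} s k (ts : Vec (Term S) m) → substTs s k (var s k) (shiftTs s (suc k) ts) ≡ ts
    substTs-var-shiftTs s k [] = refl
    substTs-var-shiftTs s k (t ∷ ts) = cong₂ _∷_ (substT-var-shiftT s k t) (substTs-var-shiftTs s k ts)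

  substF-var-shiftF : ∀ s k φ → substF s k (var s k) (shiftF s (suc k) φ) ≡ φ
  substF-var-shiftF s k ⊥' = refl
  substF-var-shiftF s k (t ≐ t') = cong₂ _≐_ (substT-var-shiftT s k t) (substT-var-shiftT s k t')
  substF-var-shiftF s k (rel R ts) = cong (rel R) (substTs-var-shiftTs s k ts)
  substF-var-shiftF s k (φ ∧' ψ) = cong₂ _∧'_ (substF-var-shiftF s k φ) (substF-var-shiftF s k ψ)
  substF-var-shiftF s k (φ ∨' ψ) = cong₂ _∨'_ (substF-var-shiftF s k φ) (substF-var-shiftF s k ψ)
  substF-var-shiftF s k (φ ⇒ ψ) = cong₂ _⇒_ (substF-var-shiftF s k φ) (substF-var-shiftF s k ψ)
  substF-var-shiftF s k (all b φ) rewrite shiftT-var-0 b s k | bumpIf-suc b s k =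
    cong (all b) (substF-var-shiftF s (bumpIf b s k) φ)
  substF-var-shiftF s k (ex b φ) rewrite shiftT-var-0 b s k | bumpIf-suc b s k =
    cong (ex b) (substF-var-shiftF s (bumpIf b s k) φ)

  mutual
    shiftT-below : ∀ d s c t → BelowT d t → d s ≤ c → shiftT s c t ≡ t
    shiftT-below d s c (var s' n) n<d ds≤c with sort-cases s' s
    ... | inj₁ refl = shiftT-var-< s (≤-trans n<d ds≤c)
    ... | inj₂ s'≢s = shiftT-var-other c n s'≢s
    shiftT-below d s c (app f ts) below ds≤c = cong (app f) (shiftTs-below d s c ts below ds≤c)

    shiftTs-below : ∀ {m} d s c (ts : Vec (Term S) m) → BelowTs d ts → d s ≤ c → shiftTs s c ts ≡ ts
    shiftTs-below d s c [] _ ds≤c = refl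
    shiftTs-below d s c (t ∷ ts) (bt , bts) ds≤c =
      cong₂ _∷_ (shiftT-below d s c t bt ds≤c) (shiftTs-below d s c ts bts ds≤c)

  shiftF-below : ∀ d s c φ → BelowF d φ → d s ≤ c → shiftF s c φ ≡ φ
  shiftF-below d s c ⊥' _ ds≤c = refl
  shiftF-below d s c (t ≐ u) (bt , bu) ds≤c =
    cong₂ _≐_ (shiftT-below d s c t bt ds≤c) (shiftT-below d s c u bu ds≤c)
  shiftF-below d s c (rel R ts) bts ds≤c = cong (rel R) (shiftTs-below d s c ts bts ds≤c)
  shiftF-below d s c (φ ∧' ψ) (bφ , bψ) ds≤c =
    cong₂ _∧'_ (shiftF-below d s c φ bφ ds≤c) (shiftF-below d s c ψ bψ ds≤c)
  shiftF-below d s c (φ ∨' ψ) (bφ , bψ) ds≤c =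
    cong₂ _∨'_ (shiftF-below d s c φ bφ ds≤c) (shiftF-below d s c ψ bψ ds≤c)
  shiftF-below d s c (φ ⇒ ψ) (bφ , bψ) ds≤c =
    cong₂ _⇒_ (shiftF-below d s c φ bφ ds≤c) (shiftF-below d s c ψ bψ ds≤c)
  shiftF-below d s c (all b φ) bφ ds≤c =
    cong (all b) (shiftF-below (bumpD b d) s (bumpIf b s c) φ bφ (bumpIf-mono-≤ b s ds≤c))
  shiftF-below d s c (ex b φ) bφ ds≤c =
    cong (ex b) (shiftF-below (bumpD b d) s (bumpIf b s c) φ bφ (bumpIf-mono-≤ b s ds≤c))

  shiftF-closed : ∀ s φ → Closed φ → shiftF s 0 φ ≡ φ
  shiftF-closed s φ closed = shiftF-below (λ _ → 0) s 0 φ closed z≤n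

  ,,-mono : ∀ {Δ Δ'} ψ → Δ ⊆′ Δ' → (Δ ,, ψ) ⊆′ (Δ' ,, ψ)
  ,,-mono ψ Δ⊆Δ' χ (inj₁ e) = inj₁ e
  ,,-mono ψ Δ⊆Δ' χ (inj₂ h) = inj₂ (Δ⊆Δ' χ h)

  shiftSet-mono : ∀ {Δ Δ'} i → Δ ⊆′ Δ' → shiftSet i Δ ⊆′ shiftSet i Δ'
  shiftSet-mono i Δ⊆Δ' χ (χ' , h , e) = χ' , Δ⊆Δ' χ' h , e

module WellSortedness {S : Symbols} (L : Signature S) where
  open Syntax {S}
  open SortedIndices {S}

  mutual
    shiftT-HasSort : ∀ s c {t i} → HasSort L t i → HasSort L (shiftT s c t) i
    shiftT-HasSort s c (var i n) with shiftT-var s c i n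
    ... | m , e rewrite e = var i m
    shiftT-HasSort s c (app ts∶ss r) = app (shiftTs-HasSorts s c ts∶ss) r

    shiftTs-HasSorts : ∀ {m} s c {ts : Vec (Term S) m} {ss} → HasSorts L ts ss → HasSorts L (shiftTs s c ts) ss
    shiftTs-HasSorts s c [] = []
    shiftTs-HasSorts s c (t∶i ∷ ts∶ss) = shiftT-HasSort s c t∶i ∷ shiftTs-HasSorts s c ts∶ss

  mutual
    substT-HasSort : ∀ s k {u t i} → HasSort L u s → HasSort L t i → HasSort L (substT s k u t) i
    substT-HasSort s k {u} u∶s (var i n) with substT-var s k u i n
    ... | inj₁ (refl , e) rewrite e = u∶s
    ... | inj₂ (m , e) rewrite e = var i m
    substT-HasSort s k u∶s (app ts∶ss r) = app (substTs-HasSorts s k u∶s ts∶ss) r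

    substTs-HasSorts : ∀ {m} s k {u} {ts : Vec (Term S) m} {ss} →
                       HasSort L u s → HasSorts L ts ss → HasSorts L (substTs s k u ts) ss
    substTs-HasSorts s k u∶s [] = []
    substTs-HasSorts s k u∶s (t∶i ∷ ts∶ss) = substT-HasSort s k u∶s t∶i ∷ substTs-HasSorts s k u∶s ts∶ss

  shiftF-WF : ∀ s c {φ} → WF L φ → WF L (shiftF s c φ)
  shiftF-WF s c ⊥' = ⊥'
  shiftF-WF s c (eq t∶i u∶i) = eq (shiftT-HasSort s c t∶i) (shiftT-HasSort s c u∶i)
  shiftF-WF s c (rel ts∶ss r) = rel (shiftTs-HasSorts s c ts∶ss) r
  shiftF-WF s c (wφ ∧' wψ) = shiftF-WF s c wφ ∧' shiftF-WF s c wψ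
  shiftF-WF s c (wφ ∨' wψ) = shiftF-WF s c wφ ∨' shiftF-WF s c wψ
  shiftF-WF s c (wφ ⇒ wψ) = shiftF-WF s c wφ ⇒ shiftF-WF s c wψ
  shiftF-WF s c (all i wφ) = all i (shiftF-WF s (bumpIf i s c) wφ)
  shiftF-WF s c (ex i wφ) = ex i (shiftF-WF s (bumpIf i s c) wφ)

  substF-WF : ∀ s k {u φ} → HasSort L u s → WF L φ → WF L (substF s k u φ)
  substF-WF s k u∶s ⊥' = ⊥'
  substF-WF s k u∶s (eq t∶i t'∶i) = eq (substT-HasSort s k u∶s t∶i) (substT-HasSort s k u∶s t'∶i)
  substF-WF s k u∶s (rel ts∶ss r) = rel (substTs-HasSorts s k u∶s ts∶ss) r
  substF-WF s k u∶s (wφ ∧' wψ) = substF-WF s k u∶s wφ ∧' substF-WF s k u∶s wψ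
  substF-WF s k u∶s (wφ ∨' wψ) = substF-WF s k u∶s wφ ∨' substF-WF s k u∶s wψ
  substF-WF s k u∶s (wφ ⇒ wψ) = substF-WF s k u∶s wφ ⇒ substF-WF s k u∶s wψ
  substF-WF s k u∶s (all i wφ) = all i (substF-WF s (bumpIf i s k) (shiftT-HasSort i 0 u∶s) wφ)
  substF-WF s k u∶s (ex i wφ) = ex i (substF-WF s (bumpIf i s k) (shiftT-HasSort i 0 u∶s) wφ)

module _ {S : Symbols} {L₁ L₂ : Signature S}
         (fun⊆ : ∀ f ss i → funRank L₁ f ss i → funRank L₂ f ss i) where
  open Syntax {S}
  open SortedIndices {S} using (,,-mono; shiftSet-mono)

  mutual
    HasSort-mono : ∀ {t i} → HasSort L₁ t i → HasSort L₂ t i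
    HasSort-mono (var i n) = var i n
    HasSort-mono (app ts∶ss r) = app (HasSorts-mono ts∶ss) (fun⊆ _ _ _ r)

    HasSorts-mono : ∀ {m} {ts : Vec (Term S) m} {ss} → HasSorts L₁ ts ss → HasSorts L₂ ts ss
    HasSorts-mono [] = []
    HasSorts-mono (t∶i ∷ ts∶ss) = HasSort-mono t∶i ∷ HasSorts-mono ts∶ss

  module _ (rel⊆ : ∀ R ss → relRank L₁ R ss → relRank L₂ R ss) where

    WF-mono : ∀ {φ} → WF L₁ φ → WF L₂ φ
    WF-mono ⊥' = ⊥'
    WF-mono (eq t∶i u∶i) = eq (HasSort-mono t∶i) (HasSort-mono u∶i)
    WF-mono (rel ts∶ss r) = rel (HasSorts-mono ts∶ss) (rel⊆ _ _ r)
    WF-mono (wφ ∧' wψ) = WF-mono wφ ∧' WF-mono wψ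
    WF-mono (wφ ∨' wψ) = WF-mono wφ ∨' WF-mono wψ
    WF-mono (wφ ⇒ wψ) = WF-mono wφ ⇒ WF-mono wψ
    WF-mono (all i wφ) = all i (WF-mono wφ)
    WF-mono (ex i wφ) = ex i (WF-mono wφ)

    Der-mono : ∀ {Δ Δ' φ} → Δ ⊆′ Δ' → Der L₁ Δ φ → Der L₂ Δ' φ
    Der-mono Δ⊆Δ' (hyp h w) = hyp (Δ⊆Δ' _ h) (WF-mono w)
    Der-mono Δ⊆Δ' (⊥E d w) = ⊥E (Der-mono Δ⊆Δ' d) (WF-mono w)
    Der-mono Δ⊆Δ' (raa d w) = raa (Der-mono (,,-mono _ Δ⊆Δ') d) (WF-mono w)
    Der-mono Δ⊆Δ' (∧I d e w) = ∧I (Der-mono Δ⊆Δ' d) (Der-mono Δ⊆Δ' e) (WF-mono w)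
    Der-mono Δ⊆Δ' (∧E₁ d w) = ∧E₁ (Der-mono Δ⊆Δ' d) (WF-mono w)
    Der-mono Δ⊆Δ' (∧E₂ d w) = ∧E₂ (Der-mono Δ⊆Δ' d) (WF-mono w)
    Der-mono Δ⊆Δ' (∨I₁ d w) = ∨I₁ (Der-mono Δ⊆Δ' d) (WF-mono w)
    Der-mono Δ⊆Δ' (∨I₂ d w) = ∨I₂ (Der-mono Δ⊆Δ' d) (WF-mono w)
    Der-mono Δ⊆Δ' (∨E d e f w) =
      ∨E (Der-mono Δ⊆Δ' d) (Der-mono (,,-mono _ Δ⊆Δ') e) (Der-mono (,,-mono _ Δ⊆Δ') f) (WF-mono w)
    Der-mono Δ⊆Δ' (⇒I d w) = ⇒I (Der-mono (,,-mono _ Δ⊆Δ') d) (WF-mono w)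
    Der-mono Δ⊆Δ' (⇒E d e w) = ⇒E (Der-mono Δ⊆Δ' d) (Der-mono Δ⊆Δ' e) (WF-mono w)
    Der-mono Δ⊆Δ' (∀I d w) = ∀I (Der-mono (shiftSet-mono _ Δ⊆Δ') d) (WF-mono w)
    Der-mono Δ⊆Δ' (∀E d t∶i w) = ∀E (Der-mono Δ⊆Δ' d) (HasSort-mono t∶i) (WF-mono w)
    Der-mono Δ⊆Δ' (∃I d t∶i w) = ∃I (Der-mono Δ⊆Δ' d) (HasSort-mono t∶i) (WF-mono w)
    Der-mono Δ⊆Δ' (∃E d e w) =
      ∃E (Der-mono Δ⊆Δ' d) (Der-mono (,,-mono _ (shiftSet-mono _ Δ⊆Δ')) e) (WF-mono w)

module Derivations {S : Symbols} (L : Signature S) where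
  open Syntax {S}
  open SortedIndices {S}
  open WellSortedness L

  Der-WF : ∀ {Δ φ} → Der L Δ φ → WF L φ
  Der-WF (hyp _ w) = w
  Der-WF (⊥E _ w) = w
  Der-WF (raa _ w) = w
  Der-WF (∧I _ _ w) = w
  Der-WF (∧E₁ _ w) = w
  Der-WF (∧E₂ _ w) = w
  Der-WF (∨I₁ _ w) = w
  Der-WF (∨I₂ _ w) = w
  Der-WF (∨E _ _ _ w) = w
  Der-WF (⇒I _ w) = w
  Der-WF (⇒E _ _ w) = w
  Der-WF (∀I _ w) = w
  Der-WF (∀E _ _ w) = w
  Der-WF (∃I _ _ w) = w
  Der-WF (∃E _ _ w) = w

  WF-∧ˡ : ∀ {a b} → WF L (a ∧' b) → WF L a
  WF-∧ˡ (w ∧' _) = w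
  WF-∧ʳ : ∀ {a b} → WF L (a ∧' b) → WF L b
  WF-∧ʳ (_ ∧' w) = w
  WF-∨ʳ : ∀ {a b} → WF L (a ∨' b) → WF L b
  WF-∨ʳ (_ ∨' w) = w
  WF-⇒ˡ : ∀ {a b} → WF L (a ⇒ b) → WF L a
  WF-⇒ˡ (w ⇒ _) = w
  WF-⇒ʳ : ∀ {a b} → WF L (a ⇒ b) → WF L b
  WF-⇒ʳ (_ ⇒ w) = w
  WF-all⁻ : ∀ {i a} → WF L (all i a) → WF L a
  WF-all⁻ (all _ w) = w
  WF-ex⁻ : ∀ {i a} → WF L (ex i a) → WF L a
  WF-ex⁻ (ex _ w) = w

  weaken : ∀ {Δ Δ' φ} → Δ ⊆′ Δ' → Der L Δ φ → Der L Δ' φ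
  weaken = Der-mono (λ _ _ _ r → r) (λ _ _ r → r)

  weaken₁ : ∀ {Θ a φ} → Der L Θ φ → Der L (Θ ,, a) φ
  weaken₁ = weaken λ _ → inj₂

  assume : ∀ {Θ a} → WF L a → Der L (Θ ,, a) a
  assume = hyp (inj₁ refl)

  cut : ∀ {Θ a φ} → Der L Θ a → Der L (Θ ,, a) φ → Der L Θ φ
  cut da d = ⇒E (⇒I d (Der-WF da ⇒ Der-WF d)) da (Der-WF d)

  ⇒-refl : ∀ {Θ a} → WF L a → Der L Θ (a ⇒ a)
  ⇒-refl w = ⇒I (assume w) (w ⇒ w)

  shiftF-all : ∀ b X → shiftF b 0 (all b X) ≡ all b (shiftF b 1 X)
  shiftF-all b X = cong (λ c → all b (shiftF b c X)) (bumpIf-same b 0)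

  shiftF-ex : ∀ b X → shiftF b 0 (ex b X) ≡ ex b (shiftF b 1 X)
  shiftF-ex b X = cong (λ c → ex b (shiftF b c X)) (bumpIf-same b 0)

  ∀E-fresh : ∀ {Θ i X} → WF L (all i X) → Θ (all i X) → Der L (shiftSet i Θ) X
  ∀E-fresh {i = i} {X} w h =
    subst (Der L _) (substF-var-shiftF i 0 X)
      (∀E (subst (Der L _) (shiftF-all i X) (hyp (_ , h , refl) (shiftF-WF i 0 w))) (var i 0)
          (subst (WF L) (sym (substF-var-shiftF i 0 X)) (WF-all⁻ w)))

  ∃I-fresh : ∀ {Θ b X} → WF L (ex b X) → Der L Θ X → Der L Θ (ex b (shiftF b 1 X))
  ∃I-fresh {b = b} {X} w d =
    ∃I (subst (Der L _) (sym (substF-var-shiftF b 0 X)) d) (var b 0)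
       (subst (WF L) (shiftF-ex b X) (shiftF-WF b 0 w))

  -- Derivability in every context satisfying Ctx, so that a derived rule can be reused under the
  -- hypotheses and shifts introduced by ⇒I, ∀I and ∃E.
  module Entailment (Ctx : (Formula S → Set) → Set)
                    (Ctx-,, : ∀ {Θ} a → Ctx Θ → Ctx (Θ ,, a))
                    (Ctx-shift : ∀ {Θ} i → Ctx Θ → Ctx (shiftSet i Θ)) where

    infix 3 _⟹_ _⟺_

    _⟹_ : Formula S → Formula S → Set₁
    a ⟹ b = ∀ {Θ} → Ctx Θ → Der L Θ (a ⇒ b)

    _⟺_ : Formula S → Formula S → Set₁
    a ⟺ b = (a ⟹ b) × (b ⟹ a)

    private
      WF-source : ∀ {Θ a b} → a ⟹ b → Ctx Θ → WF L a
      WF-source a⟹b c = WF-⇒ˡ (Der-WF (a⟹b c))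

      WF-target : ∀ {Θ a b} → a ⟹ b → Ctx Θ → WF L b
      WF-target a⟹b c = WF-⇒ʳ (Der-WF (a⟹b c))

    ⟹-apply : ∀ {Θ a b} → a ⟹ b → Ctx Θ → Der L Θ a → Der L Θ b
    ⟹-apply a⟹b c d = ⇒E (a⟹b c) d (WF-target a⟹b c)

    ⟺-refl : ∀ {a} → WF L a → a ⟺ a
    ⟺-refl w = (λ _ → ⇒-refl w) , (λ _ → ⇒-refl w)

    ∧-mono : ∀ {a a' b b'} → a ⟹ a' → b ⟹ b' → a ∧' b ⟹ a' ∧' b'
    ∧-mono a⟹a' b⟹b' c =
      ⇒I (∧I (⟹-apply a⟹a' c' (∧E₁ (assume w) wa)) (⟹-apply b⟹b' c' (∧E₂ (assume w) wb))
             (WF-target a⟹a' c ∧' WF-target b⟹b' c))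
         (w ⇒ (WF-target a⟹a' c ∧' WF-target b⟹b' c))
      where
        wa = WF-source a⟹a' c
        wb = WF-source b⟹b' c
        w = wa ∧' wb
        c' = Ctx-,, _ c

    ∨-mono : ∀ {a a' b b'} → a ⟹ a' → b ⟹ b' → a ∨' b ⟹ a' ∨' b'
    ∨-mono a⟹a' b⟹b' c =
      ⇒I (∨E (assume (wa ∨' wb))
             (∨I₁ (⟹-apply a⟹a' (Ctx-,, _ (Ctx-,, _ c)) (assume wa)) w')
             (∨I₂ (⟹-apply b⟹b' (Ctx-,, _ (Ctx-,, _ c)) (assume wb)) w') w')
         ((wa ∨' wb) ⇒ w')
      where
        wa = WF-source a⟹a' c
        wb = WF-source b⟹b' c
        w' = WF-target a⟹a' c ∨' WF-target b⟹b' c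

    ⇒-mono : ∀ {a a' b b'} → a' ⟹ a → b ⟹ b' → a ⇒ b ⟹ a' ⇒ b'
    ⇒-mono a'⟹a b⟹b' c =
      ⇒I (⇒I (⟹-apply b⟹b' c' (⇒E (hyp (inj₂ (inj₁ refl)) (wa ⇒ wb)) (⟹-apply a'⟹a c' (assume wa')) wb))
             (wa' ⇒ wb'))
         ((wa ⇒ wb) ⇒ (wa' ⇒ wb'))
      where
        wa = WF-target a'⟹a c
        wa' = WF-source a'⟹a c
        wb = WF-source b⟹b' c
        wb' = WF-target b⟹b' c
        c' = Ctx-,, _ (Ctx-,, _ c)

    all-mono : ∀ {i a a'} → a ⟹ a' → all i a ⟹ all i a'
    all-mono {i} a⟹a' c =
      ⇒I (∀I (⟹-apply a⟹a' (Ctx-shift i (Ctx-,, _ c)) (∀E-fresh (all i wa) (inj₁ refl))) (all i wa'))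
         (all i wa ⇒ all i wa')
      where
        wa = WF-source a⟹a' c
        wa' = WF-target a⟹a' c

    ex-mono : ∀ {i a a'} → a ⟹ a' → ex i a ⟹ ex i a'
    ex-mono {i} {a' = a'} a⟹a' c =
      ⇒I (∃E (assume (ex i wa))
             (subst (Der L _) (sym (shiftF-ex i a'))
               (∃I-fresh (ex i wa') (⟹-apply a⟹a' (Ctx-,, _ (Ctx-shift i (Ctx-,, _ c))) (assume wa))))
             (ex i wa'))
         (ex i wa ⇒ ex i wa')
      where
        wa = WF-source a⟹a' c
        wa' = WF-target a⟹a' c

    ∀I⋆ : ∀ {Θ} ps {X} → Ctx Θ → (∀ {Θ'} → Ctx Θ' → Der L Θ' X) → WF L (allPrefix ps X) →
          Der L Θ (allPrefix ps X)
    ∀I⋆ [] c d w = d c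
    ∀I⋆ (p ∷ ps) c d w = ∀I (∀I⋆ ps (Ctx-shift p c) d (WF-all⁻ w)) w

  ⋁ : List (Formula S) → Formula S
  ⋁ [] = ⊥'
  ⋁ (a ∷ as) = a ∨' ⋁ as

  WF-⋁ : ∀ as → (∀ {a} → a ∈ as → WF L a) → WF L (⋁ as)
  WF-⋁ [] _ = ⊥'
  WF-⋁ (a ∷ as) wf = wf (here refl) ∨' WF-⋁ as (wf ∘ there)

  WF-⋁⁻ : ∀ {as a} → WF L (⋁ as) → a ∈ as → WF L a
  WF-⋁⁻ (w ∨' _) (here refl) = w
  WF-⋁⁻ (_ ∨' w) (there a∈as) = WF-⋁⁻ w a∈as

  ⋁-intro : ∀ {as a Θ} → a ∈ as → WF L (⋁ as) → Der L Θ a → Der L Θ (⋁ as)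
  ⋁-intro (here refl) w d = ∨I₁ d w
  ⋁-intro (there a∈as) w d = ∨I₂ (⋁-intro a∈as (WF-∨ʳ w) d) w

  ⋁-elim : ∀ {as Θ φ} → WF L φ → (∀ {a} → a ∈ as → Der L (Θ ,, a) φ) →
           Der L Θ (⋁ as) → Der L Θ φ
  ⋁-elim {[]} wφ _ d = ⊥E d wφ
  ⋁-elim {a ∷ as} wφ k d =
    ∨E d (k (here refl))
         (⋁-elim wφ (λ a∈as → weaken (,,-mono _ λ _ → inj₂) (k (there a∈as))) (assume (WF-∨ʳ (Der-WF d))))
         wφ

  bigAnd-uncons : ∀ {n Θ φ} (φs : Vec (Formula S) n) → Der L Θ (bigAnd (φ ∷ φs)) →
                  Der L Θ φ × Der L Θ (bigAnd φs)
  bigAnd-uncons [] d = d , ⇒-refl ⊥'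
  bigAnd-uncons (_ ∷ _) d = ∧E₁ d (WF-∧ˡ (Der-WF d)) , ∧E₂ d (WF-∧ʳ (Der-WF d))

  bigAnd-cons : ∀ {n Θ φ} (φs : Vec (Formula S) n) → Der L Θ φ → Der L Θ (bigAnd φs) →
                Der L Θ (bigAnd (φ ∷ φs))
  bigAnd-cons [] d _ = d
  bigAnd-cons (_ ∷ _) d e = ∧I d e (Der-WF d ∧' Der-WF e)

module Compactness {S : Symbols} (L : Signature S) where
  open Syntax {S}
  open SortedIndices {S} using (,,-mono; shiftSet-mono)
  open Derivations L using (weaken)

  Listed : ∀ {Δ : Formula S → Set} → List (Σ (Formula S) Δ) → Formula S → Set
  Listed l χ = Any (λ p → χ ≡ proj₁ p) l

  private
    variable
      Δ : Formula S → Set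

    ++-listedˡ : ∀ (l₁ l₂ : List (Σ (Formula S) Δ)) → Listed l₁ ⊆′ Listed (l₁ ++ l₂)
    ++-listedˡ l₁ l₂ _ = ++⁺ˡ

    ++-listedʳ : ∀ (l₁ l₂ : List (Σ (Formula S) Δ)) → Listed l₂ ⊆′ Listed (l₁ ++ l₂)
    ++-listedʳ l₁ l₂ _ = ++⁺ʳ l₁

  discharge : ∀ ψ → List (Σ (Formula S) (Δ ,, ψ)) → List (Σ (Formula S) Δ)
  discharge ψ [] = []
  discharge ψ ((χ , inj₁ _) ∷ l) = discharge ψ l
  discharge ψ ((χ , inj₂ h) ∷ l) = (χ , h) ∷ discharge ψ l

  Listed-discharge : ∀ ψ (l : List (Σ (Formula S) (Δ ,, ψ))) → Listed l ⊆′ (Listed (discharge ψ l) ,, ψ)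
  Listed-discharge ψ ((χ , inj₁ e) ∷ l) .χ (here refl) = inj₁ e
  Listed-discharge ψ ((χ , inj₂ h) ∷ l) .χ (here refl) = inj₂ (here refl)
  Listed-discharge ψ ((χ , inj₁ e) ∷ l) χ' (there χ'∈l) = Listed-discharge ψ l χ' χ'∈l
  Listed-discharge ψ ((χ , inj₂ h) ∷ l) χ' (there χ'∈l) with Listed-discharge ψ l χ' χ'∈l
  ... | inj₁ e = inj₁ e
  ... | inj₂ χ'∈l' = inj₂ (there χ'∈l')

  unshift : ∀ i → List (Σ (Formula S) (shiftSet i Δ)) → List (Σ (Formula S) Δ)
  unshift i [] = []
  unshift i ((χ , (χ' , h , e)) ∷ l) = (χ' , h) ∷ unshift i l

  Listed-unshift : ∀ i (l : List (Σ (Formula S) (shiftSet i Δ))) → Listed l ⊆′ shiftSet i (Listed (unshift i l))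
  Listed-unshift i ((χ , (χ' , h , e)) ∷ l) .χ (here refl) = χ' , here refl , e
  Listed-unshift i (_ ∷ l) χ (there χ∈l) with Listed-unshift i l χ χ∈l
  ... | χ' , χ'∈l' , e = χ' , there χ'∈l' , e

  compact : ∀ {Δ φ} → Der L Δ φ → Σ (List (Σ (Formula S) Δ)) λ l → Der L (Listed l) φ
  compact (hyp {φ} h w) = (φ , h) ∷ [] , hyp (here refl) w
  compact (⊥E d w) with compact d
  ... | l , d' = l , ⊥E d' w
  compact (raa d w) with compact d
  ... | l , d' = discharge _ l , raa (weaken (Listed-discharge _ l) d') w
  compact (∧I d e w) with compact d | compact e
  ... | l₁ , d' | l₂ , e' = l₁ ++ l₂ , ∧I (weaken (++-listedˡ l₁ l₂) d') (weaken (++-listedʳ l₁ l₂) e') w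
  compact (∧E₁ d w) with compact d
  ... | l , d' = l , ∧E₁ d' w
  compact (∧E₂ d w) with compact d
  ... | l , d' = l , ∧E₂ d' w
  compact (∨I₁ d w) with compact d
  ... | l , d' = l , ∨I₁ d' w
  compact (∨I₂ d w) with compact d
  ... | l , d' = l , ∨I₂ d' w
  compact (∨E d e f w) with compact d | compact e | compact f
  ... | l₁ , d' | l₂ , e' | l₃ , f' =
    l₁ ++ (l₂' ++ l₃') ,
    ∨E (weaken (++-listedˡ l₁ _) d')
       (weaken (⊆′-trans (Listed-discharge _ l₂)
                  (,,-mono _ (⊆′-trans (++-listedˡ l₂' l₃') (++-listedʳ l₁ _)))) e')
       (weaken (⊆′-trans (Listed-discharge _ l₃)
                  (,,-mono _ (⊆′-trans (++-listedʳ l₂' l₃') (++-listedʳ l₁ _)))) f')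
       w
    where
      l₂' = discharge _ l₂
      l₃' = discharge _ l₃
  compact (⇒I d w) with compact d
  ... | l , d' = discharge _ l , ⇒I (weaken (Listed-discharge _ l) d') w
  compact (⇒E d e w) with compact d | compact e
  ... | l₁ , d' | l₂ , e' = l₁ ++ l₂ , ⇒E (weaken (++-listedˡ l₁ l₂) d') (weaken (++-listedʳ l₁ l₂) e') w
  compact (∀I {i} d w) with compact d
  ... | l , d' = unshift i l , ∀I (weaken (Listed-unshift i l) d') w
  compact (∀E d t∶i w) with compact d
  ... | l , d' = l , ∀E d' t∶i w
  compact (∃I d t∶i w) with compact d
  ... | l , d' = l , ∃I d' t∶i w
  compact (∃E {i} d e w) with compact d | compact e
  ... | l₁ , d' | l₂ , e' =
    l₁ ++ l₂' ,
    ∃E (weaken (++-listedˡ l₁ _) d')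
       (weaken (⊆′-trans (Listed-discharge _ l₂)
                  (,,-mono _ (⊆′-trans (Listed-unshift i (discharge _ l₂))
                                        (shiftSet-mono i (++-listedʳ l₁ _))))) e')
       w
    where
      l₂' = unshift i (discharge _ l₂)

module Instantiation {S : Symbols} where
  open Syntax {S}
  open SortedIndices {S}

  bumpIfs : List (Sort S) → Sort S → ℕ → ℕ
  bumpIfs [] s k = k
  bumpIfs (b ∷ ps) s k = bumpIfs ps s (bumpIf b s k)

  shiftT⋆ : List (Sort S) → Term S → Term S
  shiftT⋆ [] u = u
  shiftT⋆ (b ∷ ps) u = shiftT⋆ ps (shiftT b 0 u)

  substF-allPrefix : ∀ ps s k u φ →
                     substF s k u (allPrefix ps φ) ≡ allPrefix ps (substF s (bumpIfs ps s k) (shiftT⋆ ps u) φ)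
  substF-allPrefix [] s k u φ = refl
  substF-allPrefix (b ∷ ps) s k u φ = cong (all b) (substF-allPrefix ps s (bumpIf b s k) (shiftT b 0 u) φ)

  BelowF-allPrefix : ∀ ps d φ → BelowF (λ s → bumpIfs ps s (d s)) φ → BelowF d (allPrefix ps φ)
  BelowF-allPrefix [] d φ below = below
  BelowF-allPrefix (p ∷ ps) d φ below = BelowF-allPrefix ps (bumpD p d) φ below

  bumpIfs-suc : ∀ ps s k → bumpIfs ps s (suc k) ≡ suc (bumpIfs ps s k)
  bumpIfs-suc [] s k = refl
  bumpIfs-suc (b ∷ ps) s k rewrite bumpIf-suc b s k = bumpIfs-suc ps s (bumpIf b s k)

  bumpIfs-++ : ∀ ps qs s k → bumpIfs (ps ++ qs) s k ≡ bumpIfs qs s (bumpIfs ps s k)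
  bumpIfs-++ [] qs s k = refl
  bumpIfs-++ (b ∷ ps) qs s k = bumpIfs-++ ps qs s (bumpIf b s k)

  bumpIfs-≥ : ∀ ps s k → k ≤ bumpIfs ps s k
  bumpIfs-≥ [] s k = ≤-refl
  bumpIfs-≥ (b ∷ ps) s k = ≤-trans (bumpIf-≥ b s k) (bumpIfs-≥ ps s (bumpIf b s k))

  bumpIfs-replicate : ∀ N s k → bumpIfs (replicate N s) s k ≡ N + k
  bumpIfs-replicate zero s k = refl
  bumpIfs-replicate (suc N) s k rewrite bumpIf-same s k = trans (bumpIfs-replicate N s (suc k)) (+-suc N k)

  -- The effect on a term of instantiating the binders of allPrefix ps by σ, outermost first.
  substAllT : List (Sort S) → (Sort S → ℕ → Term S) → Term S → Term S
  substAllT [] σ t = t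
  substAllT (p ∷ ps) σ t = substAllT ps σ (substT p (bumpIfs ps p 0) (shiftT⋆ ps (σ p (bumpIfs ps p 0))) t)

  shiftT⋆-substT : ∀ ps p k w x →
                   substT p (bumpIfs ps p k) (shiftT⋆ ps w) (shiftT⋆ ps x) ≡ shiftT⋆ ps (substT p k w x)
  shiftT⋆-substT [] p k w x = refl
  shiftT⋆-substT (b ∷ ps) p k w x =
    trans (shiftT⋆-substT ps p (bumpIf b p k) (shiftT b 0 w) (shiftT b 0 x))
          (cong (shiftT⋆ ps) (substT-shiftT-comm p b k 0 w x λ _ → z≤n))

  substAllT-shiftT⋆ : ∀ ps σ u → substAllT ps σ (shiftT⋆ ps u) ≡ u
  substAllT-shiftT⋆ [] σ u = refl
  substAllT-shiftT⋆ (p ∷ ps) σ u =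
    trans (cong (substAllT ps σ) (trans (shiftT⋆-substT ps p 0 (σ p (bumpIfs ps p 0)) (shiftT p 0 u))
                                        (cong (shiftT⋆ ps) (substT-shiftT-cancel p 0 _ u))))
          (substAllT-shiftT⋆ ps σ u)

  substAllT-var : ∀ ps σ s j → j < bumpIfs ps s 0 → substAllT ps σ (var s j) ≡ σ s j
  substAllT-var (p ∷ ps) σ s j j<ps with sort-cases p s
  ... | inj₂ p≢s rewrite bumpIf-other 0 p≢s
                       | substT-var-other (bumpIfs ps p 0) (shiftT⋆ ps (σ p (bumpIfs ps p 0))) j (≢-sym p≢s) =
    substAllT-var ps σ s j j<ps
  ... | inj₁ refl rewrite bumpIf-same p 0 | bumpIfs-suc ps p 0 with <-cmp j (bumpIfs ps p 0)
  ...   | tri< j<c _ _ rewrite substT-var-< p (shiftT⋆ ps (σ p (bumpIfs ps p 0))) j<c = substAllT-var ps σ p j j<c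
  ...   | tri≈ _ refl _ rewrite substT-var-≡ p j (shiftT⋆ ps (σ p j)) = substAllT-shiftT⋆ ps σ (σ p j)
  ...   | tri> _ _ c<j = ⊥-elim (<-irrefl refl (<-≤-trans c<j (≤-pred j<ps)))

  data QF : Formula S → Set where
    ⊥'   : QF ⊥'
    eq   : ∀ {t u} → QF (t ≐ u)
    rel  : ∀ {R ts} → QF (rel R ts)
    _∧'_ : ∀ {a b} → QF a → QF b → QF (a ∧' b)
    _∨'_ : ∀ {a b} → QF a → QF b → QF (a ∨' b)
    _⇒_  : ∀ {a b} → QF a → QF b → QF (a ⇒ b)

  -- Only meaningful on quantifier-free formulas: quantified subformulas are left untouched.
  mapQF : (Term S → Term S) → Formula S → Formula S
  mapQF f ⊥' = ⊥'
  mapQF f (t ≐ u) = f t ≐ f u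
  mapQF f (rel R ts) = rel R (Vec.map f ts)
  mapQF f (a ∧' b) = mapQF f a ∧' mapQF f b
  mapQF f (a ∨' b) = mapQF f a ∨' mapQF f b
  mapQF f (a ⇒ b) = mapQF f a ⇒ mapQF f b
  mapQF f (all i a) = all i a
  mapQF f (ex i a) = ex i a

  QF-mapQF : ∀ f {φ} → QF φ → QF (mapQF f φ)
  QF-mapQF f ⊥' = ⊥'
  QF-mapQF f eq = eq
  QF-mapQF f rel = rel
  QF-mapQF f (a ∧' b) = QF-mapQF f a ∧' QF-mapQF f b
  QF-mapQF f (a ∨' b) = QF-mapQF f a ∨' QF-mapQF f b
  QF-mapQF f (a ⇒ b) = QF-mapQF f a ⇒ QF-mapQF f b

  mapQF-id : ∀ {φ} → QF φ → mapQF id φ ≡ φ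
  mapQF-id ⊥' = refl
  mapQF-id eq = refl
  mapQF-id {rel R ts} rel = cong (rel R) (VecP.map-id ts)
  mapQF-id (a ∧' b) = cong₂ _∧'_ (mapQF-id a) (mapQF-id b)
  mapQF-id (a ∨' b) = cong₂ _∨'_ (mapQF-id a) (mapQF-id b)
  mapQF-id (a ⇒ b) = cong₂ _⇒_ (mapQF-id a) (mapQF-id b)

  mapQF-∘ : ∀ f g {φ} → QF φ → mapQF f (mapQF g φ) ≡ mapQF (f ∘ g) φ
  mapQF-∘ f g ⊥' = refl
  mapQF-∘ f g eq = refl
  mapQF-∘ f g {rel R ts} rel = cong (rel R) (sym (VecP.map-∘ f g ts))
  mapQF-∘ f g (a ∧' b) = cong₂ _∧'_ (mapQF-∘ f g a) (mapQF-∘ f g b)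
  mapQF-∘ f g (a ∨' b) = cong₂ _∨'_ (mapQF-∘ f g a) (mapQF-∘ f g b)
  mapQF-∘ f g (a ⇒ b) = cong₂ _⇒_ (mapQF-∘ f g a) (mapQF-∘ f g b)

  shiftTs-map : ∀ {m} s c (ts : Vec (Term S) m) → shiftTs s c ts ≡ Vec.map (shiftT s c) ts
  shiftTs-map s c [] = refl
  shiftTs-map s c (t ∷ ts) = cong (_ ∷_) (shiftTs-map s c ts)

  substTs-map : ∀ {m} s k u (ts : Vec (Term S) m) → substTs s k u ts ≡ Vec.map (substT s k u) ts
  substTs-map s k u [] = refl
  substTs-map s k u (t ∷ ts) = cong (_ ∷_) (substTs-map s k u ts)

  substF-QF : ∀ s k u {φ} → QF φ → substF s k u φ ≡ mapQF (substT s k u) φ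
  substF-QF s k u ⊥' = refl
  substF-QF s k u eq = refl
  substF-QF s k u {rel R ts} rel = cong (rel R) (substTs-map s k u ts)
  substF-QF s k u (a ∧' b) = cong₂ _∧'_ (substF-QF s k u a) (substF-QF s k u b)
  substF-QF s k u (a ∨' b) = cong₂ _∨'_ (substF-QF s k u a) (substF-QF s k u b)
  substF-QF s k u (a ⇒ b) = cong₂ _⇒_ (substF-QF s k u a) (substF-QF s k u b)

  nth : ∀ {A : Set} → List A → ℕ → Maybe A
  nth [] j = nothing
  nth (x ∷ l) zero = just x
  nth (x ∷ l) (suc j) = nth l j

  Pairs : Set
  Pairs = List (Sort S × Term S)

  assign : Pairs → Sort S → ℕ → Term S
  assign P s j with nth P j
  ... | nothing = var s 0
  ... | just (s' , w) with sort-cases s' s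
  ...   | inj₁ _ = w
  ...   | inj₂ _ = var s 0

  assign-nth : ∀ P {j s w} → nth P j ≡ just (s , w) → assign P s j ≡ w
  assign-nth P {j} {s} e with nth P j
  assign-nth P {j} {s} refl | just (.s , w) with sort-cases s s
  ... | inj₁ _ = refl
  ... | inj₂ s≢s = ⊥-elim (s≢s refl)

  -- Enough binders of every sort occurring in P to close any formula whose variables are indexed by P.
  prefix : Pairs → List (Sort S)
  prefix P = concatMap (replicate (length P)) (List.map proj₁ P)

  instantiate : Pairs → Term S → Term S
  instantiate P = substAllT (prefix P) (assign P)

  private
    bumpIfs-concatMap : ∀ N ls s k → s ∈ ls → N + k ≤ bumpIfs (concatMap (replicate N) ls) s k
    bumpIfs-concatMap N (x ∷ ls) s k (here refl)
      rewrite bumpIfs-++ (replicate N s) (concatMap (replicate N) ls) s k | bumpIfs-replicate N s k =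
      bumpIfs-≥ (concatMap (replicate N) ls) s (N + k)
    bumpIfs-concatMap N (x ∷ ls) s k (there s∈ls) rewrite bumpIfs-++ (replicate N x) (concatMap (replicate N) ls) s k =
      ≤-trans (+-monoʳ-≤ N (bumpIfs-≥ (replicate N x) s k))
              (bumpIfs-concatMap N ls s (bumpIfs (replicate N x) s k) s∈ls)

    nth-∈ : ∀ (P : Pairs) {j s w} → nth P j ≡ just (s , w) → s ∈ List.map proj₁ P × j < length P
    nth-∈ ((s , w) ∷ P) {zero} refl = here refl , s≤s z≤n
    nth-∈ (_ ∷ P) {suc j} e with nth-∈ P e
    ... | s∈P , j<P = there s∈P , s≤s j<P

  prefix-bound : ∀ (P : Pairs) {j s w} → nth P j ≡ just (s , w) → j < bumpIfs (prefix P) s 0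
  prefix-bound P e with nth-∈ P e
  ... | s∈P , j<P = ≤-trans j<P (subst (_≤ bumpIfs (prefix P) _ 0) (+-identityʳ (length P))
                                      (bumpIfs-concatMap (length P) (List.map proj₁ P) _ 0 s∈P))

  instantiate-var : ∀ (P : Pairs) {j s w} → nth P j ≡ just (s , w) → instantiate P (var s j) ≡ w
  instantiate-var P e = trans (substAllT-var (prefix P) (assign P) _ _ (prefix-bound P e)) (assign-nth P e)

module ClosureInstances {S : Symbols} (L : Signature S) where
  open Syntax {S}
  open SortedIndices {S}
  open WellSortedness L
  open Derivations L
  open Instantiation {S}

  WF-allPrefix : ∀ ps {φ} → WF L φ → WF L (allPrefix ps φ)
  WF-allPrefix [] w = w
  WF-allPrefix (p ∷ ps) w = all p (WF-allPrefix ps w)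

  WF-allPrefix⁻ : ∀ ps {φ} → WF L (allPrefix ps φ) → WF L φ
  WF-allPrefix⁻ [] w = w
  WF-allPrefix⁻ (p ∷ ps) (all _ w) = WF-allPrefix⁻ ps w

  ∀E⋆ : ∀ {Θ} ps σ {φ} → (∀ s n → HasSort L (σ s n) s) → QF φ →
        Der L Θ (allPrefix ps φ) → Der L Θ (mapQF (substAllT ps σ) φ)
  ∀E⋆ [] σ σ∶ qf d = subst (Der L _) (sym (mapQF-id qf)) d
  ∀E⋆ (p ∷ ps) σ {φ} σ∶ qf d =
    subst (Der L _) (mapQF-∘ (substAllT ps σ) (substT p c u) qf)
      (∀E⋆ ps σ σ∶ (QF-mapQF _ qf)
        (subst (Der L _) (trans (substF-allPrefix ps p 0 (σ p c) φ) (cong (allPrefix ps) (substF-QF p c u qf)))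
          (∀E d (σ∶ p c) (substF-WF p 0 (σ∶ p c) (WF-all⁻ (Der-WF d))))))
    where
      c = bumpIfs ps p 0
      u = shiftT⋆ ps (σ p c)

  Sorted : Pairs → Set
  Sorted = All λ p → HasSort L (proj₂ p) (proj₁ p)

  nth-Sorted : ∀ {P j s w} → Sorted P → nth P j ≡ just (s , w) → HasSort L w s
  nth-Sorted {j = zero} (w∶s ∷ _) refl = w∶s
  nth-Sorted {j = suc j} (_ ∷ sorted) e = nth-Sorted sorted e

  assign-HasSort : ∀ P → Sorted P → ∀ s n → HasSort L (assign P s n) s
  assign-HasSort P sorted s n with nth P n in e
  ... | nothing = var s 0
  ... | just (s' , w) with sort-cases s' s
  ...   | inj₁ refl = nth-Sorted sorted e
  ...   | inj₂ _ = var s 0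

  closure-instance : ∀ {Θ ψ} (P : Pairs) → Sorted P → QF ψ → WF L ψ →
                     Θ (allPrefix (prefix P) ψ) → Der L Θ (mapQF (instantiate P) ψ)
  closure-instance P sorted qf w h =
    ∀E⋆ (prefix P) (assign P) (assign-HasSort P sorted) qf (hyp h (WF-allPrefix (prefix P) w))

module Liberalisation (S : Symbols) (L : Signature S) where
  open Syntax {S ≈Sym}
  open SortedIndices {S ≈Sym}
  open Instantiation {S ≈Sym}

  private
    Tm = Term (S ≈Sym)
    Fm = Formula (S ≈Sym)

  L⁺ : Signature S
  L⁺ = liberal L

  L≈ L⁺≈ : Signature (S ≈Sym)
  L≈ = L ≈Sig
  L⁺≈ = L⁺ ≈Sig

  infix 7 _≈_
  _≈_ : Tm → Tm → Fm
  t ≈ u = rel nothing (t ∷ u ∷ [])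

  relRank-L≈⊆L⁺≈ : ∀ R ss → relRank L≈ R ss → relRank L⁺≈ R ss
  relRank-L≈⊆L⁺≈ nothing ss _ = tt
  relRank-L≈⊆L⁺≈ (just R) ss _ = tt

  Eq≈-L⊆L⁺ : Eq≈ L ⊆′ Eq≈ L⁺
  Eq≈-L⊆L⁺ _ (ψ , ax , closure) = ψ , liberal-ax ax , closure
    where
      liberal-ax : ∀ {ψ} → OpenEq≈ L ψ → OpenEq≈ L⁺ ψ
      liberal-ax (ap-refl i) = ap-refl i
      liberal-ax (ap-sym i j) = ap-sym i j
      liberal-ax (ap-trans i j k) = ap-trans i j k
      liberal-ax (ap-rel R ss ts _ _) = ap-rel R ss ts tt tt
      liberal-ax (ap-fun f ss ts i j p q) = ap-fun f ss ts i j p q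
      liberal-ax (eq⇒ap i) = eq⇒ap i
      liberal-ax (ap⇒eq i) = ap⇒eq i

  EqAx-L≈⊆L⁺≈ : EqAx L≈ ⊆′ EqAx L⁺≈
  EqAx-L≈⊆L⁺≈ _ (ψ , ax , closure) = ψ , liberal-ax ax , closure
    where
      liberal-ax : ∀ {ψ} → OpenEqAx L≈ ψ → OpenEqAx L⁺≈ ψ
      liberal-ax (eq-refl i) = eq-refl i
      liberal-ax (eq-sym i) = eq-sym i
      liberal-ax (eq-trans i) = eq-trans i
      liberal-ax (eq-rel R ss r) = eq-rel R ss (relRank-L≈⊆L⁺≈ R ss r)
      liberal-ax (eq-fun f ss i p) = eq-fun f ss i p

  liberalise : ∀ {Γ φ} → MSL≈⊢ L Γ φ → MSL≈⊢ L⁺ Γ φ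
  liberalise = Der-mono (λ _ _ _ r → r) relRank-L≈⊆L⁺≈ λ where
    _ (inj₁ (inj₁ γ)) → inj₁ (inj₁ γ)
    _ (inj₁ (inj₂ ax)) → inj₁ (inj₂ (Eq≈-L⊆L⁺ _ ax))
    _ (inj₂ ax) → inj₂ (EqAx-L≈⊆L⁺≈ _ ax)

  open WellSortedness L≈
  open Derivations L≈
  open ClosureInstances L≈

  Axioms≈ : Fm → Set
  Axioms≈ χ = Eq≈ L χ ⊎ EqAx L≈ χ

  HasAxioms : (Fm → Set) → Set
  HasAxioms Θ = Axioms≈ ⊆′ Θ

  HasAxioms-,, : ∀ {Θ} a → HasAxioms Θ → HasAxioms (Θ ,, a)
  HasAxioms-,, a ax⊆Θ χ ax = inj₂ (ax⊆Θ χ ax)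

  HasAxioms-shift : ∀ {Θ} i → HasAxioms Θ → HasAxioms (shiftSet i Θ)
  HasAxioms-shift i ax⊆Θ χ ax = χ , ax⊆Θ χ ax , sym (shiftF-closed i χ (closed ax))
    where
      closed : ∀ {χ} → Axioms≈ χ → Closed χ
      closed (inj₁ (_ , _ , _ , _ , c)) = c
      closed (inj₂ (_ , _ , _ , _ , c)) = c

  Eq≈-instance : ∀ {Θ ψ} → HasAxioms Θ → OpenEq≈ L ψ → QF ψ → WF L≈ ψ → (P : Pairs) → Sorted P →
                 BelowF (λ s → bumpIfs (prefix P) s 0) ψ → Der L≈ Θ (mapQF (instantiate P) ψ)
  Eq≈-instance ax⊆Θ ax qf w P sorted below =
    closure-instance P sorted qf w
      (ax⊆Θ _ (inj₁ (_ , ax , prefix P , refl , BelowF-allPrefix (prefix P) (λ _ → 0) _ below)))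

  WF-≈ : ∀ {a b i j} → HasSort L≈ a i → HasSort L≈ b j → WF L≈ (a ≈ b)
  WF-≈ a∶i b∶j = rel (a∶i ∷ b∶j ∷ []) tt

  WF-≈⁻ : ∀ {a b} → WF L≈ (a ≈ b) →
          Σ (Sort S) λ i → Σ (Sort S) λ j → HasSort L≈ a i × HasSort L≈ b j
  WF-≈⁻ (rel (a∶i ∷ b∶j ∷ []) _) = _ , _ , a∶i , b∶j

  ≈-refl : ∀ {Θ a i} → HasAxioms Θ → HasSort L≈ a i → Der L≈ Θ (a ≈ a)
  ≈-refl {Θ} {a} {i} ax⊆Θ a∶i =
    subst (Der L≈ Θ) (cong₂ _≈_ (instantiate-var P refl) (instantiate-var P refl))
      (Eq≈-instance ax⊆Θ (ap-refl i) rel (WF-≈ (var i 0) (var i 0)) P (a∶i ∷ []) (x<P , x<P , tt))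
    where
      P = (i , a) ∷ []
      x<P = prefix-bound P {0} refl

  ≈-trans : ∀ {Θ a b c} → HasAxioms Θ → Der L≈ Θ (a ≈ b) → Der L≈ Θ (b ≈ c) → Der L≈ Θ (a ≈ c)
  ≈-trans {Θ} {a} {b} {c} ax⊆Θ a≈b b≈c with WF-≈⁻ (Der-WF a≈b) | WF-≈⁻ (Der-WF b≈c)
  ... | i , j , a∶i , b∶j | _ , k , _ , c∶k =
    ⇒E (subst (Der L≈ Θ) instance-eq
          (Eq≈-instance ax⊆Θ (ap-trans i j k) ((rel ∧' rel) ⇒ rel)
             ((WF-≈ (var i 0) (var j 1) ∧' WF-≈ (var j 1) (var k 2)) ⇒ WF-≈ (var i 0) (var k 2))
             P (a∶i ∷ b∶j ∷ c∶k ∷ [])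
             (((x<P , y<P , tt) , (y<P , z<P , tt)) , (x<P , z<P , tt))))
       (∧I a≈b b≈c (Der-WF a≈b ∧' Der-WF b≈c)) (WF-≈ a∶i c∶k)
    where
      P = (i , a) ∷ (j , b) ∷ (k , c) ∷ []
      x<P = prefix-bound P {0} refl
      y<P = prefix-bound P {1} refl
      z<P = prefix-bound P {2} refl
      instance-eq : mapQF (instantiate P) ((var i 0 ≈ var j 1 ∧' var j 1 ≈ var k 2) ⇒ var i 0 ≈ var k 2)
                    ≡ ((a ≈ b ∧' b ≈ c) ⇒ a ≈ c)
      instance-eq rewrite instantiate-var P {0} refl | instantiate-var P {1} refl | instantiate-var P {2} refl = refl

  ≐⇒≈ : ∀ {Θ a b} → HasAxioms Θ → Der L≈ Θ (a ≐ b) → Der L≈ Θ (a ≈ b)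
  ≐⇒≈ {Θ} {a} {b} ax⊆Θ a≐b with Der-WF a≐b
  ... | eq {i = i} a∶i b∶i =
    ⇒E (subst (Der L≈ Θ) instance-eq
          (Eq≈-instance ax⊆Θ (eq⇒ap i) (eq ⇒ rel) (eq (var i 0) (var i 1) ⇒ WF-≈ (var i 0) (var i 1))
             P (a∶i ∷ b∶i ∷ []) ((x<P , y<P) , (x<P , y<P , tt))))
       a≐b (WF-≈ a∶i b∶i)
    where
      P = (i , a) ∷ (i , b) ∷ []
      x<P = prefix-bound P {0} refl
      y<P = prefix-bound P {1} refl
      instance-eq : mapQF (instantiate P) (var i 0 ≐ var i 1 ⇒ var i 0 ≈ var i 1) ≡ (a ≐ b ⇒ a ≈ b)
      instance-eq rewrite instantiate-var P {0} refl | instantiate-var P {1} refl = refl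

  bigAnd≈ : ∀ {n} → Vec Tm n → Vec Tm n → Fm
  bigAnd≈ a b = bigAnd (Vec.zipWith _≈_ a b)

  relCongruence : (Tm → Tm → Fm) → (R : Rel S) → (a b : Vec Tm (rarity S R)) → Fm
  relCongruence _~_ R a b = bigAnd (Vec.zipWith _~_ a b) ⇒ (rel (just R) a ⇒ rel (just R) b)

  WF-bigAnd≈ : ∀ {n} {a b : Vec Tm n} {sa sb} →
               HasSorts L≈ a sa → HasSorts L≈ b sb → WF L≈ (bigAnd≈ a b)
  WF-bigAnd≈ [] [] = ⊥' ⇒ ⊥'
  WF-bigAnd≈ (x∶ ∷ []) (y∶ ∷ []) = WF-≈ x∶ y∶
  WF-bigAnd≈ (x∶ ∷ a∶@(_ ∷ _)) (y∶ ∷ b∶@(_ ∷ _)) = WF-≈ x∶ y∶ ∧' WF-bigAnd≈ a∶ b∶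

  private
    QF-bigAnd≈ : ∀ {n} (a b : Vec Tm n) → QF (bigAnd≈ a b)
    QF-bigAnd≈ [] [] = ⊥' ⇒ ⊥'
    QF-bigAnd≈ (x ∷ []) (y ∷ []) = rel
    QF-bigAnd≈ (x ∷ a@(_ ∷ _)) (y ∷ b@(_ ∷ _)) = rel ∧' QF-bigAnd≈ a b

    BelowF-bigAnd≈ : ∀ d {n} (a b : Vec Tm n) → BelowTs d a → BelowTs d b → BelowF d (bigAnd≈ a b)
    BelowF-bigAnd≈ d [] [] _ _ = tt , tt
    BelowF-bigAnd≈ d (x ∷ []) (y ∷ []) (x< , _) (y< , _) = x< , y< , tt
    BelowF-bigAnd≈ d (x ∷ a@(_ ∷ _)) (y ∷ b@(_ ∷ _)) (x< , a<) (y< , b<) =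
      (x< , y< , tt) , BelowF-bigAnd≈ d a b a< b<

    mapQF-bigAnd≈ : ∀ f {n} (a b : Vec Tm n) → mapQF f (bigAnd≈ a b) ≡ bigAnd≈ (Vec.map f a) (Vec.map f b)
    mapQF-bigAnd≈ f [] [] = refl
    mapQF-bigAnd≈ f (x ∷ []) (y ∷ []) = refl
    mapQF-bigAnd≈ f (x ∷ a@(_ ∷ _)) (y ∷ b@(_ ∷ _)) = cong (_ ∧'_) (mapQF-bigAnd≈ f a b)

    variables : ∀ {n} → Vec (Sort S) n → (Fin n → ℕ) → Vec Tm n
    variables ss index = Vec.tabulate λ k → var (Vec.lookup ss k) (index k)

    HasSorts-variables : ∀ {n} (ss : Vec (Sort S) n) index → HasSorts L≈ (variables ss index) ss
    HasSorts-variables [] index = []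
    HasSorts-variables (s ∷ ss) index = var s (index Fin.zero) ∷ HasSorts-variables ss (index ∘ Fin.suc)

    BelowTs-variables : ∀ d {n} (ss : Vec (Sort S) n) index → (∀ k → index k < d (Vec.lookup ss k)) →
                        BelowTs d (variables ss index)
    BelowTs-variables d [] index _ = tt
    BelowTs-variables d (s ∷ ss) index below =
      below Fin.zero , BelowTs-variables d ss (index ∘ Fin.suc) (below ∘ Fin.suc)

    map-variables : ∀ f {n} (ss : Vec (Sort S) n) index (v : Vec Tm n) →
                    (∀ k → f (var (Vec.lookup ss k) (index k)) ≡ Vec.lookup v k) →
                    Vec.map f (variables ss index) ≡ v
    map-variables f ss index v f-var =
      trans (sym (VecP.tabulate-∘ f _)) (trans (VecP.tabulate-cong f-var) (VecP.tabulate∘lookup v))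

    nth-++ˡ : ∀ {A : Set} (l m : List A) j {x} → nth l j ≡ just x → nth (l ++ m) j ≡ just x
    nth-++ˡ (y ∷ l) m zero e = e
    nth-++ˡ (y ∷ l) m (suc j) e = nth-++ˡ l m j e

    nth-++ʳ : ∀ {A : Set} (l m : List A) j → nth (l ++ m) (length l + j) ≡ nth m j
    nth-++ʳ [] m j = refl
    nth-++ʳ (y ∷ l) m j = nth-++ʳ l m j

    nth-zip : ∀ {n} (ss : Vec (Sort S) n) (v : Vec Tm n) (k : Fin n) →
              nth (Vec.toList (Vec.zip ss v)) (Fin.toℕ k) ≡ just (Vec.lookup ss k , Vec.lookup v k)
    nth-zip (s ∷ ss) (w ∷ v) Fin.zero = refl
    nth-zip (s ∷ ss) (w ∷ v) (Fin.suc k) = nth-zip ss v k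

    Sorted-zip : ∀ {n} {ss : Vec (Sort S) n} {v} → HasSorts L≈ v ss → Sorted (Vec.toList (Vec.zip ss v))
    Sorted-zip [] = []
    Sorted-zip (w∶s ∷ v∶ss) = w∶s ∷ Sorted-zip v∶ss

  ≈-subst-rel : ∀ {Θ} R {ss ts : Vec (Sort S) (rarity S R)} {v t} → HasAxioms Θ →
                relRank L R ss → relRank L R ts → HasSorts L≈ v ss → HasSorts L≈ t ts →
                Der L≈ Θ (relCongruence _≈_ R v t)
  ≈-subst-rel {Θ} R {ss} {ts} {v} {t} ax⊆Θ ss∈R ts∈R v∶ss t∶ts =
    subst (Der L≈ Θ) instance-eq
      (Eq≈-instance ax⊆Θ (ap-rel R ss ts ss∈R ts∈R) (QF-bigAnd≈ (xs ss) (ys ts) ⇒ (rel ⇒ rel))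
        (WF-bigAnd≈ xs∶ss ys∶ts ⇒ (rel xs∶ss ss∈R ⇒ rel ys∶ts ts∈R))
        P (All.++⁺ (Sorted-zip v∶ss) (Sorted-zip t∶ts))
        (BelowF-bigAnd≈ d (xs ss) (ys ts) xs-below ys-below , xs-below , ys-below))
    where
      n = rarity S R
      P = Vec.toList (Vec.zip ss v) ++ Vec.toList (Vec.zip ts t)
      d = λ s → bumpIfs (prefix P) s 0
      nth-x : ∀ k → nth P (Fin.toℕ k) ≡ just (Vec.lookup ss k , Vec.lookup v k)
      nth-x k = nth-++ˡ (Vec.toList (Vec.zip ss v)) _ (Fin.toℕ k) (nth-zip ss v k)
      nth-y : ∀ k → nth P (n + Fin.toℕ k) ≡ just (Vec.lookup ts k , Vec.lookup t k)
      nth-y k = trans (cong (λ m → nth P (m + Fin.toℕ k)) (sym (VecP.length-toList (Vec.zip ss v))))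
                      (trans (nth-++ʳ (Vec.toList (Vec.zip ss v)) _ (Fin.toℕ k)) (nth-zip ts t k))
      xs∶ss = HasSorts-variables ss Fin.toℕ
      ys∶ts = HasSorts-variables ts (λ k → n + Fin.toℕ k)
      xs-below = BelowTs-variables d ss Fin.toℕ (λ k → prefix-bound P (nth-x k))
      ys-below = BelowTs-variables d ts (λ k → n + Fin.toℕ k) (λ k → prefix-bound P (nth-y k))
      xs↦v = map-variables (instantiate P) ss Fin.toℕ v (λ k → instantiate-var P (nth-x k))
      ys↦t = map-variables (instantiate P) ts (λ k → n + Fin.toℕ k) t (λ k → instantiate-var P (nth-y k))
      instance-eq : mapQF (instantiate P) (relCongruence _≈_ R (xs ss) (ys ts)) ≡ relCongruence _≈_ R v t
      instance-eq = cong₂ _⇒_ (trans (mapQF-bigAnd≈ (instantiate P) (xs ss) (ys ts)) (cong₂ bigAnd≈ xs↦v ys↦t))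
                              (cong₂ _⇒_ (cong (rel (just R)) xs↦v) (cong (rel (just R)) ys↦t))

  _≟R_ : DecidableEquality (Rel S)
  R ≟R R' with relCount S
  ... | code , injective = map′ injective (cong code) (code R ℕ.≟ code R')

  ≟R-refl : (R : Rel S) → Σ (R ≡ R) λ p → (R ≟R R) ≡ yes p
  ≟R-refl R with R ≟R R
  ... | yes p = p , refl
  ... | no R≢R = ⊥-elim (R≢R refl)

  RankEntry : Set
  RankEntry = Σ (Rel S) λ R → Σ (Vec (Sort S) (rarity S R)) (relRank L R)

  toVec : ∀ {A : Set} n → List A → Maybe (Vec A n)
  toVec zero [] = just []
  toVec zero (_ ∷ _) = nothing
  toVec (suc n) [] = nothing
  toVec (suc n) (x ∷ l) = Maybe.map (x ∷_) (toVec n l)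

  toVec-toList : ∀ {A : Set} {n} (v : Vec A n) → toVec n (Vec.toList v) ≡ just v
  toVec-toList [] = refl
  toVec-toList (x ∷ v) rewrite toVec-toList v = refl

  toVec-map : ∀ {A B : Set} (f : A → B) n (l : List A) → toVec n (List.map f l) ≡ Maybe.map (Vec.map f) (toVec n l)
  toVec-map f zero [] = refl
  toVec-map f zero (x ∷ l) = refl
  toVec-map f (suc n) [] = refl
  toVec-map f (suc n) (x ∷ l) rewrite toVec-map f n l with toVec n l
  ... | just v = refl
  ... | nothing = refl

  -- A list of the wrong length gives the junk value ⊥'.
  rel? : (R : Rel S) → Maybe (Vec Tm (rarity S R)) → Fm
  rel? R (just v) = rel (just R) v
  rel? R nothing = ⊥'

  relAtom : (R : Rel S) → List Tm → Fm
  relAtom R l = rel? R (toVec (rarity S R) l)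

  -- block R ss ts pre is ∃y₁ … ∃yₙ (y₁ ≈ t₁ ∧ (… ∧ R(pre, y₁, …, yₙ))), where yₖ has sort sₖ.
  -- It reads R(pre, ts) through the rank ss of R, whatever the sorts of ts.
  block : Rel S → List (Sort S) → List Tm → List Tm → Fm
  block R [] ts pre = relAtom R pre
  block R (s ∷ ss) [] pre = ⊥'
  block R (s ∷ ss) (t ∷ ts) pre =
    ex s (var s 0 ≈ shiftT s 0 t ∧' block R ss (List.map (shiftT s 0) ts) (List.map (shiftT s 0) pre ++ var s 0 ∷ []))

  entryAtom : Rel S → RankEntry → List Tm → Fm
  entryAtom R (R' , ss , _) ts with R' ≟R R
  ... | yes _ = block R (Vec.toList ss) ts []
  ... | no _ = ⊥'

  private
    relAtom-map : (G : Fm → Fm) (f : Tm → Tm) → G ⊥' ≡ ⊥' →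
                  (∀ R v → G (rel (just R) v) ≡ rel (just R) (Vec.map f v)) →
                  ∀ R l → G (relAtom R l) ≡ relAtom R (List.map f l)
    relAtom-map G f G⊥ Grel R l rewrite toVec-map f (rarity S R) l with toVec (rarity S R) l
    ... | just v = Grel R v
    ... | nothing = G⊥

  relAtom-shiftF : ∀ s c R l → shiftF s c (relAtom R l) ≡ relAtom R (List.map (shiftT s c) l)
  relAtom-shiftF s c = relAtom-map (shiftF s c) (shiftT s c) refl λ R v → cong (rel (just R)) (shiftTs-map s c v)

  relAtom-substF : ∀ s k u R l → substF s k u (relAtom R l) ≡ relAtom R (List.map (substT s k u) l)
  relAtom-substF s k u = relAtom-map (substF s k u) (substT s k u) refl λ R v → cong (rel (just R)) (substTs-map s k u v)

  private
    shiftT-var-bound : ∀ s b c → shiftT s (bumpIf b s c) (var b 0) ≡ var b 0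
    shiftT-var-bound s b c with sort-cases b s
    ... | inj₁ refl rewrite bumpIf-same b c = shiftT-var-< b (s≤s z≤n)
    ... | inj₂ b≢s rewrite bumpIf-other c b≢s = shiftT-var-other c 0 b≢s

    substT-var-bound : ∀ s b k u → substT s (bumpIf b s k) u (var b 0) ≡ var b 0
    substT-var-bound s b k u with sort-cases b s
    ... | inj₁ refl rewrite bumpIf-same b k = substT-var-< b u (s≤s z≤n)
    ... | inj₂ b≢s rewrite bumpIf-other k b≢s = substT-var-other k u 0 b≢s

    map-shiftT-comm : ∀ s b c (l : List Tm) →
                      List.map (shiftT s (bumpIf b s c)) (List.map (shiftT b 0) l)
                        ≡ List.map (shiftT b 0) (List.map (shiftT s c) l)
    map-shiftT-comm s b c l =
      trans (sym (ListP.map-∘ l))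
            (trans (ListP.map-cong (λ t → shiftT-comm s b c 0 t λ _ → z≤n) l) (ListP.map-∘ l))

    map-substT-shiftT-comm : ∀ s b k u (l : List Tm) →
                             List.map (substT s (bumpIf b s k) (shiftT b 0 u)) (List.map (shiftT b 0) l)
                               ≡ List.map (shiftT b 0) (List.map (substT s k u) l)
    map-substT-shiftT-comm s b k u l =
      trans (sym (ListP.map-∘ l))
            (trans (ListP.map-cong (λ t → substT-shiftT-comm s b k 0 u t λ _ → z≤n) l) (ListP.map-∘ l))

  block-shiftF : ∀ s c R ss ts pre →
                 shiftF s c (block R ss ts pre) ≡ block R ss (List.map (shiftT s c) ts) (List.map (shiftT s c) pre)
  block-shiftF s c R [] ts pre = relAtom-shiftF s c R pre
  block-shiftF s c R (b ∷ ss) [] pre = refl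
  block-shiftF s c R (b ∷ ss) (t ∷ ts) pre =
    cong (ex b) (cong₂ _∧'_
      (cong₂ _≈_ (shiftT-var-bound s b c) (shiftT-comm s b c 0 t λ _ → z≤n))
      (trans (block-shiftF s (bumpIf b s c) R ss (List.map (shiftT b 0) ts) (List.map (shiftT b 0) pre ++ var b 0 ∷ []))
        (cong₂ (block R ss) (map-shiftT-comm s b c ts)
          (trans (ListP.map-++ (shiftT s (bumpIf b s c)) (List.map (shiftT b 0) pre) (var b 0 ∷ []))
            (cong₂ _++_ (map-shiftT-comm s b c pre) (cong (_∷ []) (shiftT-var-bound s b c)))))))

  block-substF : ∀ s k u R ss ts pre →
                 substF s k u (block R ss ts pre) ≡ block R ss (List.map (substT s k u) ts) (List.map (substT s k u) pre)
  block-substF s k u R [] ts pre = relAtom-substF s k u R pre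
  block-substF s k u R (b ∷ ss) [] pre = refl
  block-substF s k u R (b ∷ ss) (t ∷ ts) pre =
    cong (ex b) (cong₂ _∧'_
      (cong₂ _≈_ (substT-var-bound s b k (shiftT b 0 u)) (substT-shiftT-comm s b k 0 u t λ _ → z≤n))
      (trans (block-substF s (bumpIf b s k) (shiftT b 0 u) R ss (List.map (shiftT b 0) ts)
                           (List.map (shiftT b 0) pre ++ var b 0 ∷ []))
        (cong₂ (block R ss) (map-substT-shiftT-comm s b k u ts)
          (trans (ListP.map-++ (substT s (bumpIf b s k) (shiftT b 0 u)) (List.map (shiftT b 0) pre) (var b 0 ∷ []))
            (cong₂ _++_ (map-substT-shiftT-comm s b k u pre) (cong (_∷ []) (substT-var-bound s b k (shiftT b 0 u))))))))

  Typed : List Tm → List (Sort S) → Set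
  Typed = Pointwise (HasSort L≈)

  Typed-toList : ∀ {m} {ts : Vec Tm m} {ss} → HasSorts L≈ ts ss → Typed (Vec.toList ts) (Vec.toList ss)
  Typed-toList [] = []
  Typed-toList (t∶s ∷ ts∶ss) = t∶s ∷ Typed-toList ts∶ss

  Typed-shiftT : ∀ b c {ts ss} → Typed ts ss → Typed (List.map (shiftT b c) ts) ss
  Typed-shiftT b c [] = []
  Typed-shiftT b c (t∶s ∷ ts∶ss) = shiftT-HasSort b c t∶s ∷ Typed-shiftT b c ts∶ss

  toVec-Typed : ∀ n {l ls v} → Typed l ls → toVec n l ≡ just v →
                Σ (Vec (Sort S) n) λ vs → toVec n ls ≡ just vs × HasSorts L≈ v vs
  toVec-Typed zero [] refl = [] , refl , []
  toVec-Typed (suc n) {t ∷ l} (t∶s ∷ l∶ls) e with toVec n l in l≡v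
  toVec-Typed (suc n) {t ∷ l} (t∶s ∷ l∶ls) refl | just v with toVec-Typed n l∶ls l≡v
  ... | vs , ls≡vs , v∶vs rewrite ls≡vs = _ , refl , t∶s ∷ v∶vs
  toVec-Typed zero (_ ∷ _) ()

  InRank : Rel S → List (Sort S) → Set
  InRank R ls = ∀ vs → toVec (rarity S R) ls ≡ just vs → relRank L R vs

  InRank-toList : ∀ {R ss} → relRank L R ss → InRank R (Vec.toList ss)
  InRank-toList {ss = ss} ss∈R vs e rewrite toVec-toList ss with e
  ... | refl = ss∈R

  WF-relAtom : ∀ R {pre ps} → Typed pre ps → InRank R ps → WF L≈ (relAtom R pre)
  WF-relAtom R {pre} pre∶ps ps∈R with toVec (rarity S R) pre in pre≡v
  ... | nothing = ⊥'
  ... | just v with toVec-Typed (rarity S R) pre∶ps pre≡v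
  ...   | vs , ps≡vs , v∶vs = rel v∶vs (ps∈R vs ps≡vs)

  WF-block : ∀ R ss ts pre {ps tps} → Typed ts tps → Typed pre ps → InRank R (ps ++ ss) →
             WF L≈ (block R ss ts pre)
  WF-block R [] ts pre {ps} _ pre∶ps ps∈R = WF-relAtom R pre∶ps (subst (InRank R) (ListP.++-identityʳ ps) ps∈R)
  WF-block R (b ∷ ss) [] pre _ _ _ = ⊥'
  WF-block R (b ∷ ss) (t ∷ ts) pre {ps} (t∶s ∷ ts∶tps) pre∶ps ps∈R =
    ex b (WF-≈ (var b 0) (shiftT-HasSort b 0 t∶s) ∧'
          WF-block R ss (List.map (shiftT b 0) ts) (List.map (shiftT b 0) pre ++ var b 0 ∷ [])
            (Typed-shiftT b 0 ts∶tps) (Pointwise.++⁺ (Typed-shiftT b 0 pre∶ps) (var b 0 ∷ []))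
            (subst (InRank R) (sym (ListP.++-assoc ps (b ∷ []) ss)) ps∈R))

  WF-entryAtom : ∀ R e {ts tps} → Typed ts tps → WF L≈ (entryAtom R e ts)
  WF-entryAtom R (R' , ss , ss∈R) {ts} ts∶tps with R' ≟R R
  ... | no _ = ⊥'
  ... | yes refl = WF-block R (Vec.toList ss) ts [] ts∶tps [] (InRank-toList ss∈R)

  Assumed≈ : (Fm → Set) → List Tm → List Tm → Set
  Assumed≈ Θ = Pointwise λ a b → Θ (a ≈ b)

  private
    Assumed≈-shift : ∀ {Θ} i {as bs} → Assumed≈ Θ as bs →
                     Assumed≈ (shiftSet i Θ) (List.map (shiftT i 0) as) (List.map (shiftT i 0) bs)
    Assumed≈-shift i as≈bs = Pointwise.map⁺ (shiftT i 0) (shiftT i 0) (Pointwise.map (λ h → _ , h , refl) as≈bs)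

    WF-≈-right : ∀ {a b c d} → WF L≈ (a ≈ b) → WF L≈ (c ≈ d) → WF L≈ (b ≈ d)
    WF-≈-right (rel (_ ∷ b∶ ∷ []) _) (rel (_ ∷ d∶ ∷ []) _) = WF-≈ b∶ d∶

    map-substT-shiftT-cancel : ∀ b t (l : List Tm) → List.map (substT b 0 t) (List.map (shiftT b 0) l) ≡ l
    map-substT-shiftT-cancel b t l =
      trans (sym (ListP.map-∘ l)) (trans (ListP.map-cong (substT-shiftT-cancel b 0 t) l) (ListP.map-id l))

  block-cong : ∀ R ss ts us pre {Θ} → HasAxioms Θ → Assumed≈ Θ ts us → WF L≈ (block R ss us pre) →
               Der L≈ Θ (block R ss ts pre) → Der L≈ Θ (block R ss us pre)
  block-cong R [] ts us pre _ _ _ d = d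
  block-cong R (b ∷ ss) [] [] pre _ _ _ d = d
  block-cong R (b ∷ ss) (t ∷ ts) (u ∷ us) pre {Θ} ax⊆Θ (t≈u ∷ ts≈us) w d =
    ∃E d (subst (Der L≈ Θ₁) (sym (shiftF-ex b X)) (∃I-fresh w dX)) w
    where
      ↑ = shiftT b 0
      pre' = List.map ↑ pre ++ var b 0 ∷ []
      H = var b 0 ≈ ↑ t ∧' block R ss (List.map ↑ ts) pre'
      X = var b 0 ≈ ↑ u ∧' block R ss (List.map ↑ us) pre'
      Θ₁ = shiftSet b Θ ,, H
      wH = WF-ex⁻ (Der-WF d)
      wX = WF-ex⁻ w
      ax⊆Θ₁ = HasAxioms-,, H (HasAxioms-shift b ax⊆Θ)
      ↑t≈↑u : Der L≈ Θ₁ (↑ t ≈ ↑ u)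
      ↑t≈↑u = hyp (inj₂ (_ , t≈u , refl)) (WF-≈-right (WF-∧ˡ wH) (WF-∧ˡ wX))
      dX : Der L≈ Θ₁ X
      dX = ∧I (≈-trans ax⊆Θ₁ (∧E₁ (assume wH) (WF-∧ˡ wH)) ↑t≈↑u)
              (block-cong R ss (List.map ↑ ts) (List.map ↑ us) pre' ax⊆Θ₁
                 (Pointwise.map inj₂ (Assumed≈-shift b ts≈us)) (WF-∧ʳ wX) (∧E₂ (assume wH) (WF-∧ʳ wH)))
              wX

  block-intro : ∀ R ss ts pre {Θ} → HasAxioms Θ → Typed ts ss → WF L≈ (block R ss ts pre) →
                Der L≈ Θ (relAtom R (pre ++ ts)) → Der L≈ Θ (block R ss ts pre)
  block-intro R [] [] pre {Θ} _ [] _ d = subst (λ l → Der L≈ Θ (relAtom R l)) (ListP.++-identityʳ pre) d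
  block-intro R (b ∷ ss) (t ∷ ts) pre {Θ} ax⊆Θ (t∶b ∷ ts∶ss) w d =
    ∃I (subst (Der L≈ Θ) (sym instance-eq)
          (∧I (≈-refl ax⊆Θ t∶b) (block-intro R ss ts (pre ++ t ∷ []) ax⊆Θ ts∶ss (WF-∧ʳ w') d') w'))
       t∶b w
    where
      ↑ = shiftT b 0
      instance-eq : substF b 0 t (var b 0 ≈ ↑ t ∧' block R ss (List.map ↑ ts) (List.map ↑ pre ++ var b 0 ∷ []))
                    ≡ (t ≈ t ∧' block R ss ts (pre ++ t ∷ []))
      instance-eq =
        cong₂ _∧'_ (cong₂ _≈_ (substT-var-≡ b 0 t) (substT-shiftT-cancel b 0 t t))
          (trans (block-substF b 0 t R ss _ _)
            (cong₂ (block R ss) (map-substT-shiftT-cancel b t ts)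
              (trans (ListP.map-++ (substT b 0 t) (List.map ↑ pre) (var b 0 ∷ []))
                (cong₂ _++_ (map-substT-shiftT-cancel b t pre) (cong (_∷ []) (substT-var-≡ b 0 t))))))
      w' = subst (WF L≈) instance-eq (substF-WF b 0 t∶b (WF-ex⁻ w))
      d' = subst (λ l → Der L≈ Θ (relAtom R l)) (sym (ListP.++-assoc pre (t ∷ []) ts)) d

  bigAnd≈-assumed : ∀ {Θ} n {l m vl vm sl sm} →
                    Assumed≈ Θ l m → toVec n l ≡ just vl → toVec n m ≡ just vm →
                    HasSorts L≈ vl sl → HasSorts L≈ vm sm → Der L≈ Θ (bigAnd≈ vl vm)
  bigAnd≈-assumed zero [] refl refl [] [] = ⇒-refl ⊥'
  bigAnd≈-assumed (suc n) {a ∷ l} {b ∷ m} (a≈b ∷ l≈m) _ _ _ _ with toVec n l in l≡vl | toVec n m in m≡vm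
  bigAnd≈-assumed (suc n) (a≈b ∷ l≈m) refl refl (a∶ ∷ vl∶) (b∶ ∷ vm∶) | just vl | just vm =
    bigAnd-cons (Vec.zipWith _≈_ vl vm) (hyp a≈b (WF-≈ a∶ b∶))
                (bigAnd≈-assumed n l≈m l≡vl m≡vm vl∶ vm∶)

  relAtom-cong : ∀ R pre qs {Θ ps qps vq} → HasAxioms Θ → Assumed≈ Θ pre qs →
                 Typed pre ps → InRank R ps → Typed qs qps → InRank R qps → toVec (rarity S R) qs ≡ just vq →
                 Der L≈ Θ (relAtom R pre) → Der L≈ Θ (rel (just R) vq)
  relAtom-cong R pre qs ax⊆Θ pre≈qs pre∶ps ps∈R qs∶qps qps∈R qs≡vq d with toVec (rarity S R) pre in pre≡vp
  ... | nothing with toVec-Typed (rarity S R) qs∶qps qs≡vq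
  ...   | vqs , qps≡vqs , vq∶vqs = ⊥E d (rel vq∶vqs (qps∈R vqs qps≡vqs))
  relAtom-cong R pre qs ax⊆Θ pre≈qs pre∶ps ps∈R qs∶qps qps∈R qs≡vq d | just vp
    with toVec-Typed (rarity S R) pre∶ps pre≡vp | toVec-Typed (rarity S R) qs∶qps qs≡vq
  ... | vps , ps≡vps , vp∶vps | vqs , qps≡vqs , vq∶vqs =
    ⇒E (⇒E (≈-subst-rel R ax⊆Θ (ps∈R vps ps≡vps) (qps∈R vqs qps≡vqs) vp∶vps vq∶vqs)
           (bigAnd≈-assumed (rarity S R) pre≈qs pre≡vp qs≡vq vp∶vps vq∶vqs)
           (rel vp∶vps (ps∈R vps ps≡vps) ⇒ rel vq∶vqs (qps∈R vqs qps≡vqs)))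
       d (rel vq∶vqs (qps∈R vqs qps≡vqs))

  SameLength : List (Sort S) → List Tm → Set
  SameLength = Pointwise λ _ _ → ⊤

  SameLength-toList : ∀ {n} (ss : Vec (Sort S) n) (ts : Vec Tm n) → SameLength (Vec.toList ss) (Vec.toList ts)
  SameLength-toList [] [] = []
  SameLength-toList (_ ∷ ss) (_ ∷ ts) = tt ∷ SameLength-toList ss ts

  private
    SameLength-map : ∀ f {ss ts} → SameLength ss ts → SameLength ss (List.map f ts)
    SameLength-map f [] = []
    SameLength-map f (tt ∷ ss~ts) = tt ∷ SameLength-map f ss~ts

    ++-map-snoc : ∀ (f : Tm → Tm) qs t ts →
                  (List.map f qs ++ f t ∷ []) ++ List.map f ts ≡ List.map f (qs ++ t ∷ ts)
    ++-map-snoc f qs t ts =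
      trans (ListP.++-assoc (List.map f qs) (f t ∷ []) (List.map f ts)) (sym (ListP.map-++ f qs (t ∷ ts)))

  -- Opening the block one witness y at a time, the hypotheses y ≈ t turn R(pre, y, …) into R(qs, t, …).
  block-elim : ∀ R ss ts pre qs {Θ ps qps tps vq} → HasAxioms Θ → SameLength ss ts → Assumed≈ Θ pre qs →
               Typed pre ps → InRank R (ps ++ ss) → Typed qs qps → Typed ts tps → InRank R (qps ++ tps) →
               toVec (rarity S R) (qs ++ ts) ≡ just vq →
               Der L≈ Θ (block R ss ts pre) → Der L≈ Θ (relAtom R (qs ++ ts))
  block-elim R [] [] pre qs {Θ} {ps} {qps} {[]} {vq} ax⊆Θ [] pre≈qs pre∶ps ps∈R qs∶qps [] qps∈R qs≡vq d =
    subst (Der L≈ Θ) (sym (cong (rel? R) qs≡vq))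
      (relAtom-cong R pre qs ax⊆Θ pre≈qs pre∶ps (subst (InRank R) (ListP.++-identityʳ ps) ps∈R)
         qs∶qps (subst (InRank R) (ListP.++-identityʳ qps) qps∈R)
         (subst (λ l → toVec (rarity S R) l ≡ just vq) (ListP.++-identityʳ qs) qs≡vq) d)
  block-elim R (b ∷ ss) (t ∷ ts) pre qs {Θ} {ps} {qps} {tp ∷ tps} {vq}
             ax⊆Θ (tt ∷ ss~ts) pre≈qs pre∶ps ps∈R qs∶qps (t∶tp ∷ ts∶tps) qps∈R qs≡vq d =
    ∃E d (subst (Der L≈ Θ₁) (sym shifted-goal) (cut (∧E₁ (assume wH) (WF-∧ˡ wH)) opened)) goal-WF
    where
      ↑ = shiftT b 0
      pre' = List.map ↑ pre ++ var b 0 ∷ []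
      qs' = List.map ↑ qs ++ ↑ t ∷ []
      A = var b 0 ≈ ↑ t
      H = A ∧' block R ss (List.map ↑ ts) pre'
      Θ₁ = shiftSet b Θ ,, H
      wH = WF-ex⁻ (Der-WF d)
      shifted-goal : shiftF b 0 (relAtom R (qs ++ t ∷ ts)) ≡ relAtom R (qs' ++ List.map ↑ ts)
      shifted-goal = trans (relAtom-shiftF b 0 R (qs ++ t ∷ ts)) (cong (relAtom R) (sym (++-map-snoc ↑ qs t ts)))
      qs'≡↑vq : toVec (rarity S R) (qs' ++ List.map ↑ ts) ≡ just (Vec.map ↑ vq)
      qs'≡↑vq = trans (cong (toVec (rarity S R)) (++-map-snoc ↑ qs t ts))
                      (trans (toVec-map ↑ (rarity S R) (qs ++ t ∷ ts)) (cong (Maybe.map (Vec.map ↑)) qs≡vq))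
      opened : Der L≈ (Θ₁ ,, A) (relAtom R (qs' ++ List.map ↑ ts))
      opened = block-elim R ss (List.map ↑ ts) pre' qs'
                 (HasAxioms-,, A (HasAxioms-,, H (HasAxioms-shift b ax⊆Θ)))
                 (SameLength-map ↑ ss~ts)
                 (Pointwise.++⁺ (Pointwise.map (inj₂ ∘ inj₂) (Assumed≈-shift b pre≈qs)) (inj₁ refl ∷ []))
                 (Pointwise.++⁺ (Typed-shiftT b 0 pre∶ps) (var b 0 ∷ []))
                 (subst (InRank R) (sym (ListP.++-assoc ps (b ∷ []) ss)) ps∈R)
                 (Pointwise.++⁺ (Typed-shiftT b 0 qs∶qps) (shiftT-HasSort b 0 t∶tp ∷ []))
                 (Typed-shiftT b 0 ts∶tps)
                 (subst (InRank R) (sym (ListP.++-assoc qps (tp ∷ []) tps)) qps∈R)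
                 qs'≡↑vq
                 (∧E₂ (weaken₁ (assume wH)) (WF-∧ʳ wH))
      goal-WF : WF L≈ (relAtom R (qs ++ t ∷ ts))
      goal-WF = WF-relAtom R (Pointwise.++⁺ qs∶qps (t∶tp ∷ ts∶tps)) qps∈R

  entryAtom-cong : ∀ R e l₁ l₂ {Θ} → HasAxioms Θ → Assumed≈ Θ l₁ l₂ → WF L≈ (entryAtom R e l₂) →
                   Der L≈ Θ (entryAtom R e l₁) → Der L≈ Θ (entryAtom R e l₂)
  entryAtom-cong R (R' , ss , _) l₁ l₂ ax⊆Θ l₁≈l₂ w d with R' ≟R R
  ... | yes _ = block-cong R (Vec.toList ss) l₁ l₂ [] ax⊆Θ l₁≈l₂ w d
  ... | no _ = d

  entries : ∀ {χ} → WF L≈ χ → List RankEntry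
  entries ⊥' = []
  entries (eq _ _) = []
  entries (rel {R = nothing} _ _) = []
  entries (rel {R = just R} {ss = ss} _ ss∈R) = (R , ss , ss∈R) ∷ []
  entries (wφ ∧' wψ) = entries wφ ++ entries wψ
  entries (wφ ∨' wψ) = entries wφ ++ entries wψ
  entries (wφ ⇒ wψ) = entries wφ ++ entries wψ
  entries (all i wφ) = entries wφ
  entries (ex i wφ) = entries wφ

  module Translation (F : List RankEntry) where

    atom⁺ : Rel S → List Tm → Fm
    atom⁺ R ts = ⋁ (List.map (λ e → entryAtom R e ts) F)

    translate : Fm → Fm
    translate ⊥' = ⊥'
    translate (t ≐ u) = t ≐ u
    translate (rel nothing ts) = rel nothing ts
    translate (rel (just R) ts) = atom⁺ R (Vec.toList ts)
    translate (φ ∧' ψ) = translate φ ∧' translate ψ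
    translate (φ ∨' ψ) = translate φ ∨' translate ψ
    translate (φ ⇒ ψ) = translate φ ⇒ translate ψ
    translate (all i φ) = all i (translate φ)
    translate (ex i φ) = ex i (translate φ)

    private
      atom⁺-map : (G : Fm → Fm) (f : Tm → Tm) →
                  G ⊥' ≡ ⊥' → (∀ a b → G (a ∨' b) ≡ G a ∨' G b) →
                  (∀ R ss ts pre → G (block R ss ts pre) ≡ block R ss (List.map f ts) (List.map f pre)) →
                  ∀ R E ts → G (⋁ (List.map (λ e → entryAtom R e ts) E))
                               ≡ ⋁ (List.map (λ e → entryAtom R e (List.map f ts)) E)
      atom⁺-map G f G⊥ G∨ Gblock R [] ts = G⊥
      atom⁺-map G f G⊥ G∨ Gblock R (e ∷ E) ts =
        trans (G∨ _ _) (cong₂ _∨'_ (entryAtom-map e) (atom⁺-map G f G⊥ G∨ Gblock R E ts))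
        where
          entryAtom-map : ∀ e → G (entryAtom R e ts) ≡ entryAtom R e (List.map f ts)
          entryAtom-map (R' , ss , _) with R' ≟R R
          ... | yes _ = Gblock R (Vec.toList ss) ts []
          ... | no _ = G⊥

    translate-shiftF : ∀ s c φ → shiftF s c (translate φ) ≡ translate (shiftF s c φ)
    translate-shiftF s c ⊥' = refl
    translate-shiftF s c (t ≐ u) = refl
    translate-shiftF s c (rel nothing ts) = refl
    translate-shiftF s c (rel (just R) ts) =
      trans (atom⁺-map (shiftF s c) (shiftT s c) refl (λ _ _ → refl) (block-shiftF s c) R F (Vec.toList ts))
            (cong (atom⁺ R) (trans (sym (VecP.toList-map (shiftT s c) ts))
                                   (cong Vec.toList (sym (shiftTs-map s c ts)))))
    translate-shiftF s c (φ ∧' ψ) = cong₂ _∧'_ (translate-shiftF s c φ) (translate-shiftF s c ψ)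
    translate-shiftF s c (φ ∨' ψ) = cong₂ _∨'_ (translate-shiftF s c φ) (translate-shiftF s c ψ)
    translate-shiftF s c (φ ⇒ ψ) = cong₂ _⇒_ (translate-shiftF s c φ) (translate-shiftF s c ψ)
    translate-shiftF s c (all i φ) = cong (all i) (translate-shiftF s (bumpIf i s c) φ)
    translate-shiftF s c (ex i φ) = cong (ex i) (translate-shiftF s (bumpIf i s c) φ)

    translate-substF : ∀ s k u φ → substF s k u (translate φ) ≡ translate (substF s k u φ)
    translate-substF s k u ⊥' = refl
    translate-substF s k u (t ≐ t') = refl
    translate-substF s k u (rel nothing ts) = refl
    translate-substF s k u (rel (just R) ts) =
      trans (atom⁺-map (substF s k u) (substT s k u) refl (λ _ _ → refl) (block-substF s k u) R F (Vec.toList ts))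
            (cong (atom⁺ R) (trans (sym (VecP.toList-map (substT s k u) ts))
                                   (cong Vec.toList (sym (substTs-map s k u ts)))))
    translate-substF s k u (φ ∧' ψ) = cong₂ _∧'_ (translate-substF s k u φ) (translate-substF s k u ψ)
    translate-substF s k u (φ ∨' ψ) = cong₂ _∨'_ (translate-substF s k u φ) (translate-substF s k u ψ)
    translate-substF s k u (φ ⇒ ψ) = cong₂ _⇒_ (translate-substF s k u φ) (translate-substF s k u ψ)
    translate-substF s k u (all i φ) = cong (all i) (translate-substF s (bumpIf i s k) (shiftT i 0 u) φ)
    translate-substF s k u (ex i φ) = cong (ex i) (translate-substF s (bumpIf i s k) (shiftT i 0 u) φ)

    WF-atom⁺ : ∀ R {ts tps} → Typed ts tps → WF L≈ (atom⁺ R ts)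
    WF-atom⁺ R ts∶tps = WF-⋁ _ λ a∈ → case ∈-map⁻ _ a∈ of λ where
      (e , _ , refl) → WF-entryAtom R e ts∶tps

    translate-WF : ∀ {φ} → WF L⁺≈ φ → WF L≈ (translate φ)
    translate-WF ⊥' = ⊥'
    translate-WF (eq t∶i u∶i) = eq (HasSort-mono (λ _ _ _ r → r) t∶i) (HasSort-mono (λ _ _ _ r → r) u∶i)
    translate-WF {rel nothing ts} (rel ts∶ss _) = rel (HasSorts-mono (λ _ _ _ r → r) ts∶ss) tt
    translate-WF {rel (just R) ts} (rel ts∶ss _) = WF-atom⁺ R (Typed-toList (HasSorts-mono (λ _ _ _ r → r) ts∶ss))
    translate-WF (wφ ∧' wψ) = translate-WF wφ ∧' translate-WF wψ
    translate-WF (wφ ∨' wψ) = translate-WF wφ ∨' translate-WF wψ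
    translate-WF (wφ ⇒ wψ) = translate-WF wφ ⇒ translate-WF wψ
    translate-WF (all i wφ) = all i (translate-WF wφ)
    translate-WF (ex i wφ) = ex i (translate-WF wφ)

    open Entailment HasAxioms HasAxioms-,, HasAxioms-shift

    data Covered : Fm → Set where
      ⊥'   : Covered ⊥'
      eq   : ∀ {t u i} → HasSort L≈ t i → HasSort L≈ u i → Covered (t ≐ u)
      ≈rel : ∀ {ts ss} → HasSorts L≈ {2} ts ss → Covered (rel nothing ts)
      rel  : ∀ {R ts ss} → HasSorts L≈ ts ss → (ss∈R : relRank L R ss) → (R , ss , ss∈R) ∈ F →
             Covered (rel (just R) ts)
      _∧'_ : ∀ {φ ψ} → Covered φ → Covered ψ → Covered (φ ∧' ψ)
      _∨'_ : ∀ {φ ψ} → Covered φ → Covered ψ → Covered (φ ∨' ψ)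
      _⇒_  : ∀ {φ ψ} → Covered φ → Covered ψ → Covered (φ ⇒ ψ)
      all  : ∀ {φ} i → Covered φ → Covered (all i φ)
      ex   : ∀ {φ} i → Covered φ → Covered (ex i φ)

    Covered-WF : ∀ {φ} → Covered φ → WF L≈ φ
    Covered-WF ⊥' = ⊥'
    Covered-WF (eq t∶i u∶i) = eq t∶i u∶i
    Covered-WF (≈rel ts∶ss) = rel ts∶ss tt
    Covered-WF (rel ts∶ss ss∈R _) = rel ts∶ss ss∈R
    Covered-WF (cφ ∧' cψ) = Covered-WF cφ ∧' Covered-WF cψ
    Covered-WF (cφ ∨' cψ) = Covered-WF cφ ∨' Covered-WF cψ
    Covered-WF (cφ ⇒ cψ) = Covered-WF cφ ⇒ Covered-WF cψ
    Covered-WF (all i cφ) = all i (Covered-WF cφ)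
    Covered-WF (ex i cφ) = ex i (Covered-WF cφ)

    shiftF-Covered : ∀ s c {φ} → Covered φ → Covered (shiftF s c φ)
    shiftF-Covered s c ⊥' = ⊥'
    shiftF-Covered s c (eq t∶i u∶i) = eq (shiftT-HasSort s c t∶i) (shiftT-HasSort s c u∶i)
    shiftF-Covered s c (≈rel ts∶ss) = ≈rel (shiftTs-HasSorts s c ts∶ss)
    shiftF-Covered s c (rel ts∶ss ss∈R e∈F) = rel (shiftTs-HasSorts s c ts∶ss) ss∈R e∈F
    shiftF-Covered s c (cφ ∧' cψ) = shiftF-Covered s c cφ ∧' shiftF-Covered s c cψ
    shiftF-Covered s c (cφ ∨' cψ) = shiftF-Covered s c cφ ∨' shiftF-Covered s c cψ
    shiftF-Covered s c (cφ ⇒ cψ) = shiftF-Covered s c cφ ⇒ shiftF-Covered s c cψ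
    shiftF-Covered s c (all i cφ) = all i (shiftF-Covered s (bumpIf i s c) cφ)
    shiftF-Covered s c (ex i cφ) = ex i (shiftF-Covered s (bumpIf i s c) cφ)

    covered : ∀ {χ} (w : WF L≈ χ) → (∀ {e} → e ∈ entries w → e ∈ F) → Covered χ
    covered ⊥' _ = ⊥'
    covered (eq t∶i u∶i) _ = eq t∶i u∶i
    covered (rel {R = nothing} ts∶ss _) _ = ≈rel ts∶ss
    covered (rel {R = just R} ts∶ss ss∈R) ⊆F = rel ts∶ss ss∈R (⊆F (here refl))
    covered (wφ ∧' wψ) ⊆F = covered wφ (⊆F ∘ ++⁺ˡ) ∧' covered wψ (⊆F ∘ ++⁺ʳ (entries wφ))
    covered (wφ ∨' wψ) ⊆F = covered wφ (⊆F ∘ ++⁺ˡ) ∨' covered wψ (⊆F ∘ ++⁺ʳ (entries wφ))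
    covered (wφ ⇒ wψ) ⊆F = covered wφ (⊆F ∘ ++⁺ˡ) ⇒ covered wψ (⊆F ∘ ++⁺ʳ (entries wφ))
    covered (all i wφ) ⊆F = all i (covered wφ ⊆F)
    covered (ex i wφ) ⊆F = ex i (covered wφ ⊆F)

    private
      rel⟹atom⁺ : ∀ {R ts ss} → HasSorts L≈ ts ss → (ss∈R : relRank L R ss) → (R , ss , ss∈R) ∈ F →
                  rel (just R) ts ⟹ atom⁺ R (Vec.toList ts)
      rel⟹atom⁺ {R} {ts} {ss} ts∶ss ss∈R e∈F ax⊆Θ =
        ⇒I (⋁-intro (∈-map⁺ _ e∈F) (WF-atom⁺ R (Typed-toList ts∶ss)) entry)
           (rel ts∶ss ss∈R ⇒ WF-atom⁺ R (Typed-toList ts∶ss))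
        where
          entry : Der L≈ _ (entryAtom R (R , ss , ss∈R) (Vec.toList ts))
          entry rewrite proj₂ (≟R-refl R) =
            block-intro R (Vec.toList ss) (Vec.toList ts) [] (HasAxioms-,, _ ax⊆Θ) (Typed-toList ts∶ss)
              (WF-block R (Vec.toList ss) (Vec.toList ts) [] (Typed-toList ts∶ss) [] (InRank-toList ss∈R))
              (subst (Der L≈ _) (sym (cong (rel? R) (toVec-toList ts))) (assume (rel ts∶ss ss∈R)))

      atom⁺⟹rel : ∀ {R ts ss} → HasSorts L≈ ts ss → relRank L R ss →
                  atom⁺ R (Vec.toList ts) ⟹ rel (just R) ts
      atom⁺⟹rel {R} {ts} {ss} ts∶ss ss∈R ax⊆Θ =
        ⇒I (⋁-elim (rel ts∶ss ss∈R) disjunct (assume (WF-atom⁺ R (Typed-toList ts∶ss))))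
           (WF-atom⁺ R (Typed-toList ts∶ss) ⇒ rel ts∶ss ss∈R)
        where
          disjunct : ∀ {a} → a ∈ List.map (λ e → entryAtom R e (Vec.toList ts)) F → Der L≈ _ (rel (just R) ts)
          disjunct a∈ with ∈-map⁻ _ a∈
          ... | (R' , ss' , ss'∈R') , _ , refl with R' ≟R R
          ...   | no _ = ⊥E (assume ⊥') (rel ts∶ss ss∈R)
          ...   | yes refl =
            subst (Der L≈ _) (cong (rel? R) (toVec-toList ts))
              (block-elim R (Vec.toList ss') (Vec.toList ts) [] [] (HasAxioms-,, _ (HasAxioms-,, _ ax⊆Θ))
                 (SameLength-toList ss' ts) [] [] (InRank-toList ss'∈R') [] (Typed-toList ts∶ss)
                 (InRank-toList ss∈R) (toVec-toList ts)
                 (assume (WF-block R (Vec.toList ss') (Vec.toList ts) [] (Typed-toList ts∶ss) []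
                                   (InRank-toList ss'∈R'))))

    translate-equiv : ∀ {χ} → Covered χ → χ ⟺ translate χ
    translate-equiv ⊥' = ⟺-refl ⊥'
    translate-equiv (eq t∶i u∶i) = ⟺-refl (eq t∶i u∶i)
    translate-equiv (≈rel ts∶ss) = ⟺-refl (rel ts∶ss tt)
    translate-equiv (rel ts∶ss ss∈R e∈F) = rel⟹atom⁺ ts∶ss ss∈R e∈F , atom⁺⟹rel ts∶ss ss∈R
    translate-equiv (cφ ∧' cψ) with translate-equiv cφ | translate-equiv cψ
    ... | φ⟹ , ⟹φ | ψ⟹ , ⟹ψ = ∧-mono φ⟹ ψ⟹ , ∧-mono ⟹φ ⟹ψ
    translate-equiv (cφ ∨' cψ) with translate-equiv cφ | translate-equiv cψ
    ... | φ⟹ , ⟹φ | ψ⟹ , ⟹ψ = ∨-mono φ⟹ ψ⟹ , ∨-mono ⟹φ ⟹ψ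
    translate-equiv (cφ ⇒ cψ) with translate-equiv cφ | translate-equiv cψ
    ... | φ⟹ , ⟹φ | ψ⟹ , ⟹ψ = ⇒-mono ⟹φ ψ⟹ , ⇒-mono φ⟹ ⟹ψ
    translate-equiv (all i cφ) with translate-equiv cφ
    ... | φ⟹ , ⟹φ = all-mono φ⟹ , all-mono ⟹φ
    translate-equiv (ex i cφ) with translate-equiv cφ
    ... | φ⟹ , ⟹φ = ex-mono φ⟹ , ex-mono ⟹φ

    atom⁺-cong : ∀ R l₁ l₂ {Θ} → HasAxioms Θ → Assumed≈ Θ l₁ l₂ → WF L≈ (atom⁺ R l₂) →
                 Der L≈ Θ (atom⁺ R l₁) → Der L≈ Θ (atom⁺ R l₂)
    atom⁺-cong R l₁ l₂ {Θ} ax⊆Θ l₁≈l₂ w d = ⋁-elim w disjunct d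
      where
        disjunct : ∀ {a} → a ∈ List.map (λ e → entryAtom R e l₁) F → Der L≈ (Θ ,, a) (atom⁺ R l₂)
        disjunct a∈ with ∈-map⁻ _ a∈
        ... | e , e∈F , refl =
          ⋁-intro (∈-map⁺ _ e∈F) w
            (entryAtom-cong R e l₁ l₂ (HasAxioms-,, _ ax⊆Θ) (Pointwise.map inj₂ l₁≈l₂)
               (WF-⋁⁻ w (∈-map⁺ _ e∈F))
               (assume (WF-⋁⁻ (Der-WF d) a∈)))

    translate-allPrefix : ∀ ps ψ → translate (allPrefix ps ψ) ≡ allPrefix ps (translate ψ)
    translate-allPrefix [] ψ = refl
    translate-allPrefix (p ∷ ps) ψ = cong (all p) (translate-allPrefix ps ψ)

    translate-bigAnd : ∀ {n} (_~_ : Tm → Tm → Fm) →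
                       (∀ x y → translate (x ~ y) ≡ x ~ y) → (a b : Vec Tm n) →
                       translate (bigAnd (Vec.zipWith _~_ a b)) ≡ bigAnd (Vec.zipWith _~_ a b)
    translate-bigAnd _~_ fixed [] [] = refl
    translate-bigAnd _~_ fixed (x ∷ []) (y ∷ []) = fixed x y
    translate-bigAnd _~_ fixed (x ∷ a@(_ ∷ _)) (y ∷ b@(_ ∷ _)) =
      cong₂ _∧'_ (fixed x y) (translate-bigAnd _~_ fixed a b)

    bigAnd-assume≈ : ∀ {n} (_~_ : Tm → Tm → Fm) →
                     (∀ {Θ} x y → HasAxioms Θ → Der L≈ Θ (x ~ y) → Der L≈ Θ (x ≈ y)) →
                     (a b : Vec Tm n) → ∀ {Θ φ} → HasAxioms Θ → Der L≈ Θ (bigAnd (Vec.zipWith _~_ a b)) →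
                     (∀ {Θ'} → HasAxioms Θ' → Θ ⊆′ Θ' → Assumed≈ Θ' (Vec.toList a) (Vec.toList b) →
                               Der L≈ Θ' φ) →
                     Der L≈ Θ φ
    bigAnd-assume≈ _~_ ~⇒≈ [] [] ax⊆Θ _ k = k ax⊆Θ (λ _ h → h) []
    bigAnd-assume≈ _~_ ~⇒≈ (x ∷ a) (y ∷ b) ax⊆Θ d k with bigAnd-uncons (Vec.zipWith _~_ a b) d
    ... | x~y , rest =
      cut (~⇒≈ x y ax⊆Θ x~y)
        (bigAnd-assume≈ _~_ ~⇒≈ a b (HasAxioms-,, _ ax⊆Θ) (weaken₁ rest)
           λ ax⊆Θ' Θ⊆Θ' a≈b → k ax⊆Θ' (λ χ h → Θ⊆Θ' χ (inj₂ h)) (Θ⊆Θ' _ (inj₁ refl) ∷ a≈b))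

    Axioms⁺ : Fm → Set
    Axioms⁺ χ = Eq≈ L⁺ χ ⊎ EqAx L⁺≈ χ

    private
      fixed-axiom : ∀ {Θ} ps ψ → HasAxioms Θ → translate ψ ≡ ψ →
                    Axioms≈ (allPrefix ps ψ) → WF L⁺≈ (allPrefix ps ψ) →
                    Der L≈ Θ (translate (allPrefix ps ψ))
      fixed-axiom ps ψ ax⊆Θ fixed ax w =
        subst (Der L≈ _) (sym ψ-fixed) (hyp (ax⊆Θ _ ax) (subst (WF L≈) ψ-fixed (translate-WF w)))
        where ψ-fixed = trans (translate-allPrefix ps ψ) (cong (allPrefix ps) fixed)

      -- Under the premises a ~ b, atom⁺ R a ⇒ atom⁺ R b follows from the congruence of each block.
      congruence-axiom : ∀ {Θ} ps (_~_ : Tm → Tm → Fm) R (a b : Vec Tm (rarity S R)) →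
                         (∀ x y → translate (x ~ y) ≡ x ~ y) →
                         (∀ {Θ'} x y → HasAxioms Θ' → Der L≈ Θ' (x ~ y) → Der L≈ Θ' (x ≈ y)) → HasAxioms Θ →
                         WF L⁺≈ (allPrefix ps (relCongruence _~_ R a b)) →
                         Der L≈ Θ (translate (allPrefix ps (relCongruence _~_ R a b)))
      congruence-axiom ps _~_ R a b fixed ~⇒≈ ax⊆Θ w =
        subst (Der L≈ _) (sym translated) (∀I⋆ ps ax⊆Θ body (subst (WF L≈) translated (translate-WF w)))
        where
          B = bigAnd (Vec.zipWith _~_ a b)
          X = B ⇒ (atom⁺ R (Vec.toList a) ⇒ atom⁺ R (Vec.toList b))
          translated : translate (allPrefix ps (B ⇒ (rel (just R) a ⇒ rel (just R) b))) ≡ allPrefix ps X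
          translated = trans (translate-allPrefix ps _)
                             (cong (λ C → allPrefix ps (C ⇒ _)) (translate-bigAnd _~_ fixed a b))
          wX : WF L≈ X
          wX = WF-allPrefix⁻ ps (subst (WF L≈) translated (translate-WF w))
          body : ∀ {Θ'} → HasAxioms Θ' → Der L≈ Θ' X
          body ax⊆Θ' =
            ⇒I (bigAnd-assume≈ _~_ ~⇒≈ a b (HasAxioms-,, _ ax⊆Θ') (assume (WF-⇒ˡ wX))
                  λ ax⊆Θ'' _ a≈b →
                    ⇒I (atom⁺-cong R _ _ (HasAxioms-,, _ ax⊆Θ'') (Pointwise.map inj₂ a≈b) (WF-⇒ʳ (WF-⇒ʳ wX))
                                   (assume (WF-⇒ˡ (WF-⇒ʳ wX))))
                       (WF-⇒ʳ wX))
               wX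

      data Eq≈⁺-Case : Fm → Set where
        congruence : ∀ R (ss ts : Vec (Sort S) (rarity S R)) →
                     Eq≈⁺-Case (relCongruence _≈_ R (xs ss) (ys ts))
        fixed      : ∀ {ψ} → OpenEq≈ L ψ → translate ψ ≡ ψ → Eq≈⁺-Case ψ

      Eq≈⁺-case : ∀ {ψ} → OpenEq≈ L⁺ ψ → Eq≈⁺-Case ψ
      Eq≈⁺-case (ap-refl i) = fixed (ap-refl i) refl
      Eq≈⁺-case (ap-sym i j) = fixed (ap-sym i j) refl
      Eq≈⁺-case (ap-trans i j k) = fixed (ap-trans i j k) refl
      Eq≈⁺-case (ap-rel R ss ts _ _) = congruence R ss ts
      Eq≈⁺-case (ap-fun f ss ts i j p q) =
        fixed (ap-fun f ss ts i j p q) (cong₂ _⇒_ (translate-bigAnd _≈_ (λ _ _ → refl) (xs ss) (ys ts)) refl)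
      Eq≈⁺-case (eq⇒ap i) = fixed (eq⇒ap i) refl
      Eq≈⁺-case (ap⇒eq i) = fixed (ap⇒eq i) refl

      data EqAx⁺-Case : Fm → Set where
        congruence : ∀ R (ss : Vec (Sort S) (rarity S R)) →
                     EqAx⁺-Case (relCongruence _≐_ R (xs ss) (ys ss))
        fixed      : ∀ {ψ} → OpenEqAx L≈ ψ → translate ψ ≡ ψ → EqAx⁺-Case ψ

      EqAx⁺-case : ∀ {ψ} → OpenEqAx L⁺≈ ψ → EqAx⁺-Case ψ
      EqAx⁺-case (eq-refl i) = fixed (eq-refl i) refl
      EqAx⁺-case (eq-sym i) = fixed (eq-sym i) refl
      EqAx⁺-case (eq-trans i) = fixed (eq-trans i) refl
      EqAx⁺-case (eq-rel nothing ss _) =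
        fixed (eq-rel nothing ss tt) (cong₂ _⇒_ (translate-bigAnd _≐_ (λ _ _ → refl) (xs ss) (ys ss)) refl)
      EqAx⁺-case (eq-rel (just R) ss _) = congruence R ss
      EqAx⁺-case (eq-fun f ss i p) =
        fixed (eq-fun f ss i p) (cong₂ _⇒_ (translate-bigAnd _≐_ (λ _ _ → refl) (xs ss) (ys ss)) refl)

    translate-axiom : ∀ {Θ χ} → HasAxioms Θ → Axioms⁺ χ → WF L⁺≈ χ → Der L≈ Θ (translate χ)
    translate-axiom ax⊆Θ (inj₁ (ψ , ax , ps , refl , c)) with Eq≈⁺-case ax
    ... | congruence R ss ts = congruence-axiom ps _≈_ R (xs ss) (ys ts) (λ _ _ → refl) (λ _ _ _ d → d) ax⊆Θ
    ... | fixed ax′ ψ-fixed = fixed-axiom ps ψ ax⊆Θ ψ-fixed (inj₁ (ψ , ax′ , ps , refl , c))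
    translate-axiom ax⊆Θ (inj₂ (ψ , ax , ps , refl , c)) with EqAx⁺-case ax
    ... | congruence R ss = congruence-axiom ps _≐_ R (xs ss) (ys ss) (λ _ _ → refl) (λ _ _ → ≐⇒≈) ax⊆Θ
    ... | fixed ax′ ψ-fixed = fixed-axiom ps ψ ax⊆Θ ψ-fixed (inj₂ (ψ , ax′ , ps , refl , c))

    module _ {Γ G : Fm → Set} (G⊆Γ : ∀ χ → G χ → Γ χ × Covered χ) where

      data Corresponding : (Fm → Set) → (Fm → Set) → Set₁ where
        base   : Corresponding ((G ∪ Eq≈ L⁺) ∪ EqAx L⁺≈) ((Γ ∪ Eq≈ L) ∪ EqAx L≈)
        extend : ∀ {Δ Δ'} ψ → Corresponding Δ Δ' → Corresponding (Δ ,, ψ) (Δ' ,, translate ψ)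
        shift  : ∀ {Δ Δ'} i → Corresponding Δ Δ' → Corresponding (shiftSet i Δ) (shiftSet i Δ')

      Corresponding-HasAxioms : ∀ {Δ Δ'} → Corresponding Δ Δ' → HasAxioms Δ'
      Corresponding-HasAxioms base χ (inj₁ ax) = inj₁ (inj₂ ax)
      Corresponding-HasAxioms base χ (inj₂ ax) = inj₂ ax
      Corresponding-HasAxioms (extend ψ r) = HasAxioms-,, _ (Corresponding-HasAxioms r)
      Corresponding-HasAxioms (shift i r) = HasAxioms-shift i (Corresponding-HasAxioms r)

      private
        closed⁺ : ∀ {χ} → Axioms⁺ χ → Closed χ
        closed⁺ (inj₁ (_ , _ , _ , _ , c)) = c
        closed⁺ (inj₂ (_ , _ , _ , _ , c)) = c

      hypothesis-cases : ∀ {Δ Δ' χ} → Corresponding Δ Δ' → Δ χ →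
                         Δ' (translate χ) ⊎ (Δ' χ × Covered χ) ⊎ Axioms⁺ χ
      hypothesis-cases base (inj₁ (inj₁ g)) with G⊆Γ _ g
      ... | γ , c = inj₂ (inj₁ (inj₁ (inj₁ γ) , c))
      hypothesis-cases base (inj₁ (inj₂ ax)) = inj₂ (inj₂ (inj₁ ax))
      hypothesis-cases base (inj₂ ax) = inj₂ (inj₂ (inj₂ ax))
      hypothesis-cases (extend ψ r) (inj₁ refl) = inj₁ (inj₁ refl)
      hypothesis-cases (extend ψ r) (inj₂ h) with hypothesis-cases r h
      ... | inj₁ h' = inj₁ (inj₂ h')
      ... | inj₂ (inj₁ (h' , c)) = inj₂ (inj₁ (inj₂ h' , c))
      ... | inj₂ (inj₂ ax) = inj₂ (inj₂ ax)
      hypothesis-cases (shift i r) (χ' , h , refl) with hypothesis-cases r h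
      ... | inj₁ h' = inj₁ (translate χ' , h' , sym (translate-shiftF i 0 χ'))
      ... | inj₂ (inj₁ (h' , c)) = inj₂ (inj₁ ((χ' , h' , refl) , shiftF-Covered i 0 c))
      ... | inj₂ (inj₂ ax) rewrite shiftF-closed i χ' (closed⁺ ax) = inj₂ (inj₂ ax)

      translate-hyp : ∀ {Δ Δ' χ} → Corresponding Δ Δ' → Δ χ → WF L⁺≈ χ → Der L≈ Δ' (translate χ)
      translate-hyp r h w with hypothesis-cases r h
      ... | inj₁ h' = hyp h' (translate-WF w)
      ... | inj₂ (inj₁ (h' , c)) =
        ⟹-apply (proj₁ (translate-equiv c)) (Corresponding-HasAxioms r) (hyp h' (Covered-WF c))
      ... | inj₂ (inj₂ ax) = translate-axiom (Corresponding-HasAxioms r) ax w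

      translate-Der : ∀ {Δ Δ' φ} → Corresponding Δ Δ' → Der L⁺≈ Δ φ → Der L≈ Δ' (translate φ)
      translate-Der r (hyp h w) = translate-hyp r h w
      translate-Der r (⊥E d w) = ⊥E (translate-Der r d) (translate-WF w)
      translate-Der r (raa d w) = raa (translate-Der (extend _ r) d) (translate-WF w)
      translate-Der r (∧I d e w) = ∧I (translate-Der r d) (translate-Der r e) (translate-WF w)
      translate-Der r (∧E₁ d w) = ∧E₁ (translate-Der r d) (translate-WF w)
      translate-Der r (∧E₂ d w) = ∧E₂ (translate-Der r d) (translate-WF w)
      translate-Der r (∨I₁ d w) = ∨I₁ (translate-Der r d) (translate-WF w)
      translate-Der r (∨I₂ d w) = ∨I₂ (translate-Der r d) (translate-WF w)
      translate-Der r (∨E d e f w) =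
        ∨E (translate-Der r d) (translate-Der (extend _ r) e) (translate-Der (extend _ r) f) (translate-WF w)
      translate-Der r (⇒I d w) = ⇒I (translate-Der (extend _ r) d) (translate-WF w)
      translate-Der r (⇒E d e w) = ⇒E (translate-Der r d) (translate-Der r e) (translate-WF w)
      translate-Der r (∀I {i} d w) = ∀I (translate-Der (shift i r) d) (translate-WF w)
      translate-Der r (∀E {i} {φ} {t} d t∶i w) =
        subst (Der L≈ _) (translate-substF i 0 t φ)
          (∀E (translate-Der r d) (HasSort-mono (λ _ _ _ r → r) t∶i)
              (subst (WF L≈) (sym (translate-substF i 0 t φ)) (translate-WF w)))
      translate-Der r (∃I {i} {φ} {t} d t∶i w) =
        ∃I (subst (Der L≈ _) (sym (translate-substF i 0 t φ)) (translate-Der r d))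
           (HasSort-mono (λ _ _ _ r → r) t∶i) (translate-WF w)
      translate-Der r (∃E {i} {φ} {ψ} d e w) =
        ∃E (translate-Der r d)
           (subst (Der L≈ _) (sym (translate-shiftF i 0 ψ)) (translate-Der (extend φ (shift i r)) e))
           (translate-WF w)

  module _ {Γ : Fm → Set} (Γ-WF : ∀ χ → Γ χ → WF L≈ χ) where
    open Compactness L⁺≈

    private
      Hyps⁺ : Fm → Set
      Hyps⁺ = (Γ ∪ Eq≈ L⁺) ∪ EqAx L⁺≈

      premises : List (Σ Fm Hyps⁺) → List (Σ Fm Γ)
      premises [] = []
      premises ((χ , inj₁ (inj₁ γ)) ∷ l) = (χ , γ) ∷ premises l
      premises ((χ , inj₁ (inj₂ _)) ∷ l) = premises l
      premises ((χ , inj₂ _) ∷ l) = premises l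

      Listed-premises : ∀ l → Listed l ⊆′ ((Listed (premises l) ∪ Eq≈ L⁺) ∪ EqAx L⁺≈)
      Listed-premises ((χ , inj₁ (inj₁ γ)) ∷ l) .χ (here refl) = inj₁ (inj₁ (here refl))
      Listed-premises ((χ , inj₁ (inj₂ ax)) ∷ l) .χ (here refl) = inj₁ (inj₂ ax)
      Listed-premises ((χ , inj₂ ax) ∷ l) .χ (here refl) = inj₂ ax
      Listed-premises ((χ , inj₁ (inj₁ γ)) ∷ l) χ' (there χ'∈l) with Listed-premises l χ' χ'∈l
      ... | inj₁ (inj₁ χ'∈l') = inj₁ (inj₁ (there χ'∈l'))
      ... | inj₁ (inj₂ ax) = inj₁ (inj₂ ax)
      ... | inj₂ ax = inj₂ ax
      Listed-premises ((χ , inj₁ (inj₂ _)) ∷ l) χ' (there χ'∈l) = Listed-premises l χ' χ'∈l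
      Listed-premises ((χ , inj₂ _) ∷ l) χ' (there χ'∈l) = Listed-premises l χ' χ'∈l

      premiseEntries : List (Σ Fm Γ) → List RankEntry
      premiseEntries [] = []
      premiseEntries ((χ , γ) ∷ gl) = entries (Γ-WF χ γ) ++ premiseEntries gl

      premises-covered : ∀ F gl → (∀ {e} → e ∈ premiseEntries gl → e ∈ F) →
                         ∀ χ → Listed gl χ → Γ χ × Translation.Covered F χ
      premises-covered F ((χ , γ) ∷ gl) ⊆F .χ (here refl) =
        γ , Translation.covered F (Γ-WF χ γ) (⊆F ∘ ++⁺ˡ)
      premises-covered F ((χ , γ) ∷ gl) ⊆F χ' (there χ'∈gl) =
        premises-covered F gl (⊆F ∘ ++⁺ʳ (entries (Γ-WF χ γ))) χ' χ'∈gl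

    unliberalise : ∀ {φ} → WF L≈ φ → MSL≈⊢ L⁺ Γ φ → MSL≈⊢ L Γ φ
    unliberalise {φ} wφ d with compact d
    ... | l , d' =
      ⟹-apply (proj₂ (translate-equiv φ-covered)) (Corresponding-HasAxioms Γ-covered base)
        (translate-Der Γ-covered base (Derivations.weaken L⁺≈ (Listed-premises l) d'))
      where
        F = premiseEntries (premises l) ++ entries wφ
        open Translation F
        open Entailment HasAxioms HasAxioms-,, HasAxioms-shift using (⟹-apply)
        φ-covered = covered wφ (++⁺ʳ (premiseEntries (premises l)))
        Γ-covered = premises-covered F (premises l) ++⁺ˡ

lemmaB1 : (S : Symbols) (L : Signature S)
          (Γ : Formula (S ≈Sym) → Set) (φ : Formula (S ≈Sym)) →
          (∀ χ → Γ χ → WF (L ≈Sig) χ) → WF (L ≈Sig) φ →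
          (MSL≈⊢ L Γ φ → MSL≈⊢ (liberal L) Γ φ) × (MSL≈⊢ (liberal L) Γ φ → MSL≈⊢ L Γ φ)
lemmaB1 S L Γ φ Γ-WF φ-WF = liberalise , unliberalise Γ-WF φ-WF
  where open Liberalisation S L
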